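{- Let $G$ be a saturated connected graph with $|E(G)| \leq |V(G)|$ and $2 \leq mp(G) \leq 3$. (1) If $mp(G)=2$, then $G = K_{1,\Delta}$ for some $\Delta\ge 1$. Moreover, if $\Delta \geq 2$, then $mp(G+e)=3$ for every edge $e$ joining two nonadjacent vertices of $G$. (2) If $mp(G)=3$, then $G=K_3$.
   Context: All graphs are finite and simple. A degree monotone path in a graph $G$ is a path $v_1v_2\ldots v_m$ such that $\deg(v_1)\le\cdots\le\deg(v_m)$ or $\deg(v_1)\ge\cdots\ge\deg(v_m)$, where degrees are taken in $G$. Its length is its number of vertices $m$. $mp(G)$ denotes the maximum length of a degree monotone path in $G$. A graph $G$ is called saturated if $mp(G+e) > mp(G)$ for every edge $e$ joining two nonadjacent vertices of $G$, where $G+e$ is $G$ with $e$ added. This holds vacuously for complete graphs such as $K_3$. -}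

module Defs where

open import Data.Bool using (Bool; true; false; T; _∨_; _∧_; if_then_else_)
open import Data.Nat using (ℕ; zero; suc; _+_; _≤_; _<_; _≥_)
open import Data.Fin using (Fin; toℕ) renaming (zero to fzero; suc to fsuc)
open import Data.Fin.Properties using (_≟_)
open import Data.List using (List; length; map; allFin)
open import Data.Nat.ListAction using (sum)
open import Data.List.Relation.Unary.Linked using (Linked)
open import Data.List.Relation.Unary.Unique.Propositional using (Unique)
open import Data.Product using (Σ; _×_; ∃)
open import Data.Sum using (_⊎_)
open import Relation.Binary.PropositionalEquality using (_≡_; _≢_)
open import Relation.Nullary.Decidable using (⌊_⌋)

Graph : ℕ → Set
Graph n = Fin n → Fin n → Bool

Simple : ∀ {n} → Graph n → Set
Simple {n} G = (∀ (i j : Fin n) → G i j ≡ G j i) × (∀ (i : Fin n) → G i i ≡ false)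

b2n : Bool → ℕ
b2n true  = 1
b2n false = 0

deg : ∀ {n} → Graph n → Fin n → ℕ
deg {n} G i = sum (map (λ j → b2n (G i j)) (allFin n))

edgeCount : ∀ {n} → Graph n → ℕ
edgeCount {n} G =
  sum (map (λ i → sum (map (λ j → b2n (⌊ Data.Nat._<?_ (toℕ i) (toℕ j) ⌋ ∧ G i j)) (allFin n))) (allFin n))

-- paths: lists of distinct vertices, consecutive ones adjacent; length = number of vertices
IsPath : ∀ {n} → Graph n → List (Fin n) → Set
IsPath G xs = Unique xs × Linked (λ a b → T (G a b)) xs

DegMonotone : ∀ {n} → Graph n → List (Fin n) → Set
DegMonotone G xs = Linked (λ a b → deg G a ≤ deg G b) xs ⊎ Linked (λ a b → deg G a ≥ deg G b) xs

IsDMP : ∀ {n} → Graph n → List (Fin n) → Set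
IsDMP G xs = IsPath G xs × DegMonotone G xs

IsMP : ∀ {n} → Graph n → ℕ → Set
IsMP G m = Σ _ (λ xs → IsDMP G xs × length xs ≡ m) × (∀ xs → IsDMP G xs → length xs ≤ m)

addEdge : ∀ {n} → Graph n → Fin n → Fin n → Graph n
addEdge G u v i j = G i j ∨ (⌊ i ≟ u ⌋ ∧ ⌊ j ≟ v ⌋) ∨ (⌊ i ≟ v ⌋ ∧ ⌊ j ≟ u ⌋)

Saturated : ∀ {n} → Graph n → Set
Saturated {n} G = ∀ (u v : Fin n) → u ≢ v → G u v ≡ false →
  ∀ m m' → IsMP G m → IsMP (addEdge G u v) m' → m < m'

data Walk {n} (G : Graph n) : Fin n → Fin n → Set where
  here : ∀ {u} → Walk G u u
  step : ∀ {u w v} → T (G u w) → Walk G w v → Walk G u v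

Connected : ∀ {n} → Graph n → Set
Connected {n} G = ∀ (u v : Fin n) → Walk G u v

record Iso {n m} (G : Graph n) (H : Graph m) : Set where
  field
    f : Fin n → Fin m
    g : Fin m → Fin n
    gf : ∀ i → g (f i) ≡ i
    fg : ∀ j → f (g j) ≡ j
    pres : ∀ i j → G i j ≡ H (f i) (f j)

K3 : Graph 3
K3 i j = if ⌊ i ≟ j ⌋ then false else true

Star : (Δ : ℕ) → Graph (suc Δ)
Star Δ fzero    fzero    = false
Star Δ fzero    (fsuc _) = true
Star Δ (fsuc _) fzero    = true
Star Δ (fsuc _) (fsuc _) = false

module Submission where

-- The handshake lemma turns |E| ≤ n into
-- ∑ deg ≤ 2n, so, all degrees being ≥ 1 by connectivity, G has a leaf or is 2-regular.  Monotone
-- paths matter only on 3 and 4 vertices: mp = 2 (resp. 3) excludes ascending 3-vertex (resp.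
-- 4-vertex) paths, and saturation says that adding any non-edge uv creates one; AddEdge records
-- how the degrees of G + uv differ from those of G.
--   mp = 2: the middle of every 2-edge path is a strict peak or valley.  Around a leaf u at w, a
--   peak of degree ≥ 2 other than w is excluded by adding uv, so G is a star centred at w.
--   mp = 3: a 2-regular G is a triangle.  Otherwise, with a leaf and a vertex m of maximum degree,
--   saturation puts every leaf at m and makes m the unique maximum; the remaining configurations
--   (deg m = 2, two leaves at m, a single leaf at m) are excluded in turn, the last one after the
--   degree sum forces deg m = 3 and all other degrees 2.
-- Order: sums and counts, neighbours and handshake, AddEdge, short monotone paths and saturation,
-- connectivity, mp = 2 (Mp2, StarIso, StarPlusEdge), mp = 3 (TriangleIso, Mp3), the theorem.

open import Defs
open import Data.Nat using (ℕ; zero; suc; _+_; _*_; _≤_; _<_; z≤n; s≤s; _≤?_; _<?_) renaming (_≟_ to _≟ℕ_)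
open import Data.Nat.Properties
  using (≤-refl; ≤-trans; <⇒≱; ≤-antisym; ≤-reflexive; ≤-total; ≤-pred; <⇒≤; ≰⇒>; <-irrefl; <-asym; <-cmp;
         n≤1+n; +-mono-≤; +-monoˡ-≤; +-monoʳ-≤; +-cancelˡ-≤; +-comm; +-suc; +-identityʳ;
         *-comm; *-zeroʳ; suc-injective; +-commutativeSemigroup; module ≤-Reasoning)
open import Algebra.Properties.CommutativeSemigroup +-commutativeSemigroup using (interchange)
open import Data.Fin using (Fin; toℕ) renaming (zero to fzero; suc to fsuc)
open import Data.Fin.Properties using (_≟_; any?; toℕ-injective)
open import Data.Bool using (Bool; true; false; T; _∨_; _∧_)
open import Data.Bool.Properties using (¬-not; ∨-identityʳ; ∨-comm; ∧-comm; T-≡) renaming (_≟_ to _≟ᵇ_)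
open import Data.Fin.Permutation.Components using (transpose; transpose-inverse)
open import Data.List using ([]; _∷_; length; map; allFin; tabulate)
open import Data.List.Properties using (map-tabulate)
open import Data.Nat.ListAction using (sum)
open import Data.List.Relation.Unary.Linked using ([]; [-]; _∷_)
open import Data.List.Relation.Unary.All using ([]; _∷_)
open import Data.List.Relation.Unary.AllPairs using ([]; _∷_)
open import Data.Product using (Σ; _×_; ∃; _,_; proj₁; proj₂)
open import Data.Sum using (_⊎_; inj₁; inj₂)
open import Data.Empty using (⊥; ⊥-elim)
open import Function using (_∘_; id)
open import Function.Bundles using (Equivalence)
open import Relation.Nullary using (¬_; Dec; yes; no)
open import Relation.Nullary.Decidable using (⌊_⌋; ¬?; _×-dec_; toWitness; toSum; dec-true)
open import Relation.Binary.Definitions using (tri<; tri≈; tri>)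
open import Relation.Binary.PropositionalEquality
  using (_≡_; _≢_; refl; sym; trans; cong; cong₂; subst; subst₂; ≢-sym; module ≡-Reasoning)

-- Equality of vertices as a sum.  Splitting on it with 'with' does not disturb goals mentioning
-- 'addEdge', which contains '_≟_' itself.
_≟⊎_ : ∀ {n} (x y : Fin n) → x ≡ y ⊎ x ≢ y
x ≟⊎ y = toSum (x ≟ y)

≟-yes : ∀ {n} {x y : Fin n} → x ≡ y → ⌊ x ≟ y ⌋ ≡ true
≟-yes {x = x} {y} x≡y with x ≟ y
... | yes _   = refl
... | no x≢y = ⊥-elim (x≢y x≡y)

≟-no : ∀ {n} {x y : Fin n} → x ≢ y → ⌊ x ≟ y ⌋ ≡ false
≟-no {x = x} {y} x≢y with x ≟ y
... | yes x≡y = ⊥-elim (x≢y x≡y)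
... | no _    = refl

∑ : ∀ n → (Fin n → ℕ) → ℕ
∑ zero    f = 0
∑ (suc n) f = f fzero + ∑ n (f ∘ fsuc)

sum-allFin : ∀ n (f : Fin n → ℕ) → sum (map f (allFin n)) ≡ ∑ n f
sum-allFin n f = trans (cong sum (map-tabulate id f)) (sum-tabulate n f)
  where
  sum-tabulate : ∀ n (g : Fin n → ℕ) → sum (tabulate g) ≡ ∑ n g
  sum-tabulate zero    g = refl
  sum-tabulate (suc n) g = cong (g fzero +_) (sum-tabulate n (g ∘ fsuc))

∑-cong : ∀ n {f g : Fin n → ℕ} → (∀ i → f i ≡ g i) → ∑ n f ≡ ∑ n g
∑-cong zero    f≗g = refl
∑-cong (suc n) f≗g = cong₂ _+_ (f≗g fzero) (∑-cong n (f≗g ∘ fsuc))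

∑-mono : ∀ n {f g : Fin n → ℕ} → (∀ i → f i ≤ g i) → ∑ n f ≤ ∑ n g
∑-mono zero    f≤g = z≤n
∑-mono (suc n) f≤g = +-mono-≤ (f≤g fzero) (∑-mono n (f≤g ∘ fsuc))

∑-+ : ∀ n (f g : Fin n → ℕ) → ∑ n (λ i → f i + g i) ≡ ∑ n f + ∑ n g
∑-+ zero    f g = refl
∑-+ (suc n) f g =
  trans (cong (f fzero + g fzero +_) (∑-+ n (f ∘ fsuc) (g ∘ fsuc)))
        (interchange (f fzero) (g fzero) (∑ n (f ∘ fsuc)) (∑ n (g ∘ fsuc)))

∑-const : ∀ n c → ∑ n (λ _ → c) ≡ n * c
∑-const zero    c = refl
∑-const (suc n) c = cong (c +_) (∑-const n c)

∑-swap : ∀ n m (f : Fin n → Fin m → ℕ) → ∑ n (λ i → ∑ m (f i)) ≡ ∑ m (λ j → ∑ n (λ i → f i j))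
∑-swap zero    m f = sym (trans (∑-const m 0) (*-zeroʳ m))
∑-swap (suc n) m f =
  trans (cong (∑ m (f fzero) +_) (∑-swap n m (f ∘ fsuc)))
        (sym (∑-+ m (f fzero) (λ j → ∑ n (λ i → f (fsuc i) j))))

∑-squeeze : ∀ n {f g : Fin n → ℕ} → (∀ i → f i ≤ g i) → ∑ n g ≤ ∑ n f → ∀ i → g i ≤ f i
∑-squeeze (suc n) {f} {g} f≤g tot fzero =
  +-cancelˡ-≤ (∑ n (f ∘ fsuc)) _ _ (subst₂ _≤_ (+-comm (g fzero) _) (+-comm (f fzero) _)
    (≤-trans (+-monoʳ-≤ (g fzero) (∑-mono n (f≤g ∘ fsuc))) tot))
∑-squeeze (suc n) {f} {g} f≤g tot (fsuc i) =
  ∑-squeeze n (f≤g ∘ fsuc) (+-cancelˡ-≤ (g fzero) _ _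
    (≤-trans tot (+-mono-≤ (f≤g fzero) ≤-refl))) i

one-or-constant-two : ∀ n (f : Fin n → ℕ) → (∀ x → 1 ≤ f x) → ∑ n f ≤ n * 2 →
                      (∃ λ u → f u ≡ 1) ⊎ (∀ x → f x ≡ 2)
one-or-constant-two n f pos avg with any? (λ x → f x ≤? 1)
... | yes (u , fu≤1) = inj₁ (u , ≤-antisym fu≤1 (pos u))
... | no  none       = inj₂ λ x → ≤-antisym (at-most-2 x) (at-least-2 x)
  where
  at-least-2 : ∀ x → 2 ≤ f x
  at-least-2 x with f x ≤? 1
  ... | yes fx≤1 = ⊥-elim (none (x , fx≤1))
  ... | no  fx≰1 = ≰⇒> fx≰1
  at-most-2 : ∀ x → f x ≤ 2
  at-most-2 = ∑-squeeze n at-least-2 (subst (∑ n f ≤_) (sym (∑-const n 2)) avg)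

count : ∀ {n} → (Fin n → Bool) → ℕ
count {n} p = ∑ n (b2n ∘ p)

remove : ∀ {n} → (Fin n → Bool) → Fin n → Fin n → Bool
remove p fzero    fzero    = false
remove p fzero    (fsuc j) = p (fsuc j)
remove p (fsuc a) fzero    = p fzero
remove p (fsuc a) (fsuc j) = remove (p ∘ fsuc) a j

remove-self : ∀ {n} (p : Fin n → Bool) a → remove p a a ≡ false
remove-self p fzero    = refl
remove-self p (fsuc a) = remove-self (p ∘ fsuc) a

remove-other : ∀ {n} (p : Fin n → Bool) a j → j ≢ a → remove p a j ≡ p j
remove-other p fzero    fzero    j≢a = ⊥-elim (j≢a refl)
remove-other p fzero    (fsuc j) j≢a = refl
remove-other p (fsuc a) fzero    j≢a = refl
remove-other p (fsuc a) (fsuc j) j≢a = remove-other (p ∘ fsuc) a j (λ { refl → j≢a refl })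

remove-sound : ∀ {n} (p : Fin n → Bool) a j → remove p a j ≡ true → p j ≡ true × j ≢ a
remove-sound p a j rj with j ≟ a
... | yes refl with () ← trans (sym rj) (remove-self p a)
... | no  j≢a = trans (sym (remove-other p a j j≢a)) rj , j≢a

remove-keeps : ∀ {n} (p : Fin n → Bool) a j → p j ≡ true → j ≢ a → remove p a j ≡ true
remove-keeps p a j pj j≢a = trans (remove-other p a j j≢a) pj

count-remove : ∀ {n} (p : Fin n → Bool) a → p a ≡ true → count p ≡ suc (count (remove p a))
count-remove p fzero    pa rewrite pa = refl
count-remove p (fsuc a) pa =
  trans (cong (b2n (p fzero) +_) (count-remove (p ∘ fsuc) a pa)) (+-suc (b2n (p fzero)) _)

count-insert : ∀ {n} (p q : Fin n → Bool) a → p a ≡ true → q a ≡ false → (∀ j → j ≢ a → p j ≡ q j) →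
               count p ≡ suc (count q)
count-insert {n} p q a pa qa agree = trans (count-remove p a pa) (cong suc (∑-cong n (cong b2n ∘ same)))
  where
  same : ∀ j → remove p a j ≡ q j
  same j with j ≟ a
  ... | yes refl = trans (remove-self p a) (sym qa)
  ... | no  j≢a  = trans (remove-other p a j j≢a) (agree j j≢a)

count-zero : ∀ {n} (p : Fin n → Bool) → count p ≡ 0 → ∀ i → p i ≡ false
count-zero p h i with p i in pi
... | false = refl
... | true with () ← trans (sym h) (count-remove p i pi)

count-none : ∀ {n} (p : Fin n → Bool) → (∀ i → p i ≡ false) → count p ≡ 0
count-none {zero}  p none = refl
count-none {suc n} p none rewrite none fzero = count-none (p ∘ fsuc) (none ∘ fsuc)

count-point : ∀ {n} (a : Fin n) → count (λ x → ⌊ x ≟ a ⌋) ≡ 1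
count-point {n} a = trans (count-insert _ (λ _ → false) a (≟-yes refl) refl (λ _ → ≟-no))
                      (cong suc (count-none {n} (λ _ → false) (λ _ → refl)))

count-witness : ∀ {n} (p : Fin n → Bool) → 1 ≤ count p → ∃ λ i → p i ≡ true
count-witness {suc n} p h with p fzero in p0
... | true  = fzero , p0
... | false with i , pi ← count-witness (p ∘ fsuc) h = fsuc i , pi

count-second : ∀ {n} (p : Fin n → Bool) a → p a ≡ true → 2 ≤ count p → ∃ λ b → b ≢ a × p b ≡ true
count-second p a pa h rewrite count-remove p a pa
  with b , rb ← count-witness (remove p a) (≤-pred h)
  with pb , b≢a ← remove-sound p a b rb = b , b≢a , pb

count-third : ∀ {n} (p : Fin n → Bool) a b → p a ≡ true → p b ≡ true → b ≢ a → 3 ≤ count p →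
              ∃ λ c → c ≢ a × c ≢ b × p c ≡ true
count-third p a b pa pb b≢a h rewrite count-remove p a pa
  with c , c≢b , rc ← count-second (remove p a) b (remove-keeps p a b pb b≢a) (≤-pred h)
  with pc , c≢a ← remove-sound p a c rc = c , c≢a , c≢b , pc

count-after-remove : ∀ {n k} (p : Fin n → Bool) a → p a ≡ true → count p ≡ suc k → count (remove p a) ≡ k
count-after-remove p a pa h = suc-injective (trans (sym (count-remove p a pa)) h)

count-one : ∀ {n} (p : Fin n → Bool) a → count p ≡ 1 → p a ≡ true → ∀ y → p y ≡ true → y ≡ a
count-one p a h pa y py with y ≟ a
... | yes y≡a = y≡a
... | no  y≢a with () ← trans (sym (count-zero (remove p a) (count-after-remove p a pa h) y))
                              (remove-keeps p a y py y≢a)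

count-two : ∀ {n} (p : Fin n → Bool) a b → count p ≡ 2 → p a ≡ true → p b ≡ true → b ≢ a →
            ∀ y → p y ≡ true → y ≡ a ⊎ y ≡ b
count-two p a b h pa pb b≢a y py with y ≟ a
... | yes y≡a = inj₁ y≡a
... | no  y≢a = inj₂ (count-one (remove p a) b (count-after-remove p a pa h)
                        (remove-keeps p a b pb b≢a) y (remove-keeps p a y py y≢a))

count-three : ∀ {n} (p : Fin n → Bool) a b c → count p ≡ 3 → p a ≡ true → p b ≡ true → p c ≡ true →
              b ≢ a → c ≢ a → c ≢ b → ∀ y → p y ≡ true → y ≡ a ⊎ y ≡ b ⊎ y ≡ c
count-three p a b c h pa pb pc b≢a c≢a c≢b y py with y ≟ a
... | yes y≡a = inj₁ y≡a
... | no  y≢a = inj₂ (count-two (remove p a) b c (count-after-remove p a pa h)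
                        (remove-keeps p a b pb b≢a) (remove-keeps p a c pc c≢a) c≢b
                        y (remove-keeps p a y py y≢a))

count-≥1 : ∀ {n} (p : Fin n → Bool) a → p a ≡ true → 1 ≤ count p
count-≥1 p a pa rewrite count-remove p a pa = s≤s z≤n

count-≥2 : ∀ {n} (p : Fin n → Bool) a b → p a ≡ true → p b ≡ true → b ≢ a → 2 ≤ count p
count-≥2 p a b pa pb b≢a rewrite count-remove p a pa =
  s≤s (count-≥1 (remove p a) b (remove-keeps p a b pb b≢a))

count-≥3 : ∀ {n} (p : Fin n → Bool) a b c → p a ≡ true → p b ≡ true → p c ≡ true →
           b ≢ a → c ≢ a → c ≢ b → 3 ≤ count p
count-≥3 p a b c pa pb pc b≢a c≢a c≢b rewrite count-remove p a pa =
  s≤s (count-≥2 (remove p a) b c (remove-keeps p a b pb b≢a) (remove-keeps p a c pc c≢a) c≢b)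

Adj : ∀ {n} → Graph n → Fin n → Fin n → Set
Adj G a b = G a b ≡ true

T⇒≡true : ∀ {b} → T b → b ≡ true
T⇒≡true = Equivalence.to T-≡

≡true⇒T : ∀ {b} → b ≡ true → T b
≡true⇒T = Equivalence.from T-≡

true≢false : true ≢ false
true≢false ()

module _ {n} {G : Graph n} (sG : Simple G) where

  adj-irrefl : ∀ {a b} → Adj G a b → a ≢ b
  adj-irrefl {a} ab refl = true≢false (trans (sym ab) (proj₂ sG a))

  adj-sym : ∀ {a b} → Adj G a b → Adj G b a
  adj-sym {a} {b} ab = trans (proj₁ sG b a) ab

module Neighbours {n} (G : Graph n) where

  deg-count : ∀ x → deg G x ≡ count (G x)
  deg-count x = sum-allFin n (b2n ∘ G x)

  neighbour : ∀ x → 1 ≤ deg G x → ∃ λ a → Adj G x a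
  neighbour x h = count-witness (G x) (subst (1 ≤_) (deg-count x) h)

  second-neighbour : ∀ x a → 2 ≤ deg G x → Adj G x a → ∃ λ b → b ≢ a × Adj G x b
  second-neighbour x a h xa = count-second (G x) a xa (subst (2 ≤_) (deg-count x) h)

  third-neighbour : ∀ x a b → 3 ≤ deg G x → Adj G x a → Adj G x b → b ≢ a →
                    ∃ λ c → c ≢ a × c ≢ b × Adj G x c
  third-neighbour x a b h xa xb b≢a = count-third (G x) a b xa xb b≢a (subst (3 ≤_) (deg-count x) h)

  only-neighbour : ∀ x a → deg G x ≡ 1 → Adj G x a → ∀ y → Adj G x y → y ≡ a
  only-neighbour x a h = count-one (G x) a (trans (sym (deg-count x)) h)

  two-neighbours : ∀ x a b → deg G x ≡ 2 → Adj G x a → Adj G x b → b ≢ a →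
                   ∀ y → Adj G x y → y ≡ a ⊎ y ≡ b
  two-neighbours x a b h = count-two (G x) a b (trans (sym (deg-count x)) h)

  three-neighbours : ∀ x a b c → deg G x ≡ 3 → Adj G x a → Adj G x b → Adj G x c →
                     b ≢ a → c ≢ a → c ≢ b → ∀ y → Adj G x y → y ≡ a ⊎ y ≡ b ⊎ y ≡ c
  three-neighbours x a b c h = count-three (G x) a b c (trans (sym (deg-count x)) h)

  deg≥1 : ∀ x a → Adj G x a → 1 ≤ deg G x
  deg≥1 x a xa = subst (1 ≤_) (sym (deg-count x)) (count-≥1 (G x) a xa)

  deg≥2 : ∀ x a b → Adj G x a → Adj G x b → b ≢ a → 2 ≤ deg G x
  deg≥2 x a b xa xb b≢a = subst (2 ≤_) (sym (deg-count x)) (count-≥2 (G x) a b xa xb b≢a)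

  deg≥3 : ∀ x a b c → Adj G x a → Adj G x b → Adj G x c → b ≢ a → c ≢ a → c ≢ b → 3 ≤ deg G x
  deg≥3 x a b c xa xb xc b≢a c≢a c≢b =
    subst (3 ≤_) (sym (deg-count x)) (count-≥3 (G x) a b c xa xb xc b≢a c≢a c≢b)

  deg≡1 : ∀ x a → Adj G x a → (∀ y → Adj G x y → y ≡ a) → deg G x ≡ 1
  deg≡1 x a xa only = trans (deg-count x) (trans (count-remove (G x) a xa) (cong suc (count-none _ none)))
    where
    none : ∀ i → remove (G x) a i ≡ false
    none i = ¬-not λ ri → let (xi , i≢a) = remove-sound (G x) a i ri in i≢a (only i xi)

open Neighbours public

module _ {n} (G : Graph n) (sG : Simple G) where

  private
    Up : Fin n → Fin n → ℕ
    Up i j = b2n (⌊ toℕ i <? toℕ j ⌋ ∧ G i j)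

    <?-true : ∀ {m k} → m < k → ⌊ m <? k ⌋ ≡ true
    <?-true {m} {k} m<k with m <? k
    ... | yes _  = refl
    ... | no m≮k = ⊥-elim (m≮k m<k)

    <?-false : ∀ {m k} → ¬ (m < k) → ⌊ m <? k ⌋ ≡ false
    <?-false {m} {k} m≮k with m <? k
    ... | yes m<k = ⊥-elim (m≮k m<k)
    ... | no _    = refl

    -- each edge ij is counted by exactly one of Up i j, Up j i
    split : ∀ i j → b2n (G i j) ≡ Up i j + Up j i
    split i j with <-cmp (toℕ i) (toℕ j)
    ... | tri< i<j _ j≮i rewrite <?-true i<j | <?-false j≮i = sym (+-identityʳ _)
    ... | tri> i≮j _ j<i rewrite <?-true j<i | <?-false i≮j | proj₁ sG i j = refl
    ... | tri≈ i≮j i≡j j≮i rewrite <?-false i≮j | <?-false j≮i | toℕ-injective i≡j | proj₂ sG j = refl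

    edgeCount-∑ : edgeCount G ≡ ∑ n (λ i → ∑ n (Up i))
    edgeCount-∑ = trans (sum-allFin n _) (∑-cong n (λ i → sum-allFin n _))

  handshake : ∑ n (deg G) ≡ edgeCount G + edgeCount G
  handshake = begin
      ∑ n (deg G)
    ≡⟨ ∑-cong n (λ i → trans (deg-count G i) (∑-cong n (split i))) ⟩
      ∑ n (λ i → ∑ n (λ j → Up i j + Up j i))
    ≡⟨ ∑-cong n (λ i → ∑-+ n (Up i) (λ j → Up j i)) ⟩
      ∑ n (λ i → ∑ n (Up i) + ∑ n (λ j → Up j i))
    ≡⟨ ∑-+ n (λ i → ∑ n (Up i)) (λ i → ∑ n (λ j → Up j i)) ⟩
      ∑ n (λ i → ∑ n (Up i)) + ∑ n (λ i → ∑ n (λ j → Up j i))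
    ≡⟨ cong (∑ n (λ i → ∑ n (Up i)) +_) (∑-swap n n (λ i j → Up j i)) ⟩
      ∑ n (λ i → ∑ n (Up i)) + ∑ n (λ i → ∑ n (Up i))
    ≡⟨ cong₂ _+_ (sym edgeCount-∑) (sym edgeCount-∑) ⟩
      edgeCount G + edgeCount G ∎
    where open ≡-Reasoning

  degree-sum-bound : edgeCount G ≤ n → ∑ n (deg G) ≤ n * 2
  degree-sum-bound e≤n rewrite handshake | *-comm n 2 | +-identityʳ n = +-mono-≤ e≤n e≤n

connected-closed : ∀ {n} {G : Graph n} → Connected G → (S : Fin n → Set) → ∀ a → S a →
                   (∀ x y → S x → Adj G x y → S y) → ∀ z → S z
connected-closed {G = G} cG S a sa closed z = go (cG a z) sa
  where
  go : ∀ {x z} → Walk G x z → S x → S z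
  go here               sx = sx
  go (step {u} {w} t wk) su = go wk (closed u w su (T⇒≡true t))

argmax : ∀ {n} (f : Fin n → ℕ) → Fin n → ∃ λ v → ∀ x → f x ≤ f v
argmax {suc zero}    f _ = fzero , λ { fzero → ≤-refl }
argmax {suc (suc n)} f _ with w , max ← argmax (f ∘ fsuc) fzero with f fzero ≤? f (fsuc w)
... | yes f0≤ = fsuc w , λ { fzero → f0≤ ; (fsuc x) → max x }
... | no  f0≰ = fzero  , λ { fzero → ≤-refl ; (fsuc x) → ≤-trans (max x) (<⇒≤ (≰⇒> f0≰)) }

module AddEdge {n} (G : Graph n) (sG : Simple G) (u v : Fin n) (u≢v : u ≢ v) (¬uv : G u v ≡ false) where

  H : Graph n
  H = addEdge G u v

  private
    or-of-ands : ∀ g a b c d → g ∨ (a ∧ b) ∨ (c ∧ d) ≡ true →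
                 g ≡ true ⊎ (a ≡ true × b ≡ true) ⊎ (c ≡ true × d ≡ true)
    or-of-ands true  a     b     c    d    _ = inj₁ refl
    or-of-ands false true  true  c    d    _ = inj₂ (inj₁ (refl , refl))
    or-of-ands false true  false true true _ = inj₂ (inj₂ (refl , refl))
    or-of-ands false false b     true true _ = inj₂ (inj₂ (refl , refl))

    is : ∀ {x y : Fin n} → ⌊ x ≟ y ⌋ ≡ true → x ≡ y
    is = toWitness ∘ ≡true⇒T

  old-edge : ∀ {i j} → Adj G i j → Adj H i j
  old-edge {i} {j} gij rewrite gij = refl

  new-edge : Adj H u v
  new-edge rewrite ¬uv | ≟-yes {x = u} refl | ≟-yes {x = v} refl = refl

  edge-cases : ∀ {i j} → Adj H i j → Adj G i j ⊎ (i ≡ u × j ≡ v) ⊎ (i ≡ v × j ≡ u)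
  edge-cases {i} {j} hij with or-of-ands (G i j) ⌊ i ≟ u ⌋ ⌊ j ≟ v ⌋ ⌊ i ≟ v ⌋ ⌊ j ≟ u ⌋ hij
  ... | inj₁ gij              = inj₁ gij
  ... | inj₂ (inj₁ (iu , jv)) = inj₂ (inj₁ (is iu , is jv))
  ... | inj₂ (inj₂ (iv , ju)) = inj₂ (inj₂ (is iv , is ju))

  old-off-u : ∀ {x y} → x ≢ u → y ≢ u → Adj H x y → Adj G x y
  old-off-u x≢u y≢u xy with edge-cases xy
  ... | inj₁ xy′              = xy′
  ... | inj₂ (inj₁ (x≡u , _)) = ⊥-elim (x≢u x≡u)
  ... | inj₂ (inj₂ (_ , y≡u)) = ⊥-elim (y≢u y≡u)

  old-off-uv : ∀ {x y} → x ≢ u → x ≢ v → Adj H x y → Adj G x y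
  old-off-uv x≢u x≢v xy with edge-cases xy
  ... | inj₁ xy′              = xy′
  ... | inj₂ (inj₁ (x≡u , _)) = ⊥-elim (x≢u x≡u)
  ... | inj₂ (inj₂ (x≡v , _)) = ⊥-elim (x≢v x≡v)

  u-neighbours : ∀ {w} → (∀ y → Adj G u y → y ≡ w) → ∀ y → Adj H u y → y ≡ w ⊎ y ≡ v
  u-neighbours only y uy with edge-cases uy
  ... | inj₁ uy′              = inj₁ (only y uy′)
  ... | inj₂ (inj₁ (_ , y≡v)) = inj₂ y≡v
  ... | inj₂ (inj₂ (u≡v , _)) = ⊥-elim (u≢v u≡v)

  v-neighbours : ∀ {w} → (∀ y → Adj G v y → y ≡ w) → ∀ y → Adj H v y → y ≡ w ⊎ y ≡ u
  v-neighbours only y vy with edge-cases vy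
  ... | inj₁ vy′              = inj₁ (only y vy′)
  ... | inj₂ (inj₁ (v≡u , _)) = ⊥-elim (u≢v (sym v≡u))
  ... | inj₂ (inj₂ (_ , y≡u)) = inj₂ y≡u

  simple : Simple H
  simple = symmetric , loopless
    where
    symmetric : ∀ i j → H i j ≡ H j i
    symmetric i j = cong₂ _∨_ (proj₁ sG i j)
      (trans (∨-comm (⌊ i ≟ u ⌋ ∧ ⌊ j ≟ v ⌋) _) (cong₂ _∨_ (∧-comm ⌊ i ≟ v ⌋ _) (∧-comm ⌊ i ≟ u ⌋ _)))
    loopless : ∀ i → H i i ≡ false
    loopless i with H i i in hii
    ... | false = refl
    ... | true with edge-cases hii
    ...   | inj₁ gii             = ⊥-elim (true≢false (trans (sym gii) (proj₂ sG i)))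
    ...   | inj₂ (inj₁ (iu , iv)) = ⊥-elim (u≢v (trans (sym iu) iv))
    ...   | inj₂ (inj₂ (iv , iu)) = ⊥-elim (u≢v (trans (sym iu) iv))

  deg-other : ∀ i → i ≢ u → i ≢ v → deg H i ≡ deg G i
  deg-other i i≢u i≢v = begin
      deg H i              ≡⟨ deg-count H i ⟩
      count (H i)          ≡⟨ ∑-cong n (λ j → cong b2n (same j)) ⟩
      count (G i)          ≡⟨ deg-count G i ⟨
      deg G i ∎
    where
    open ≡-Reasoning
    same : ∀ j → H i j ≡ G i j
    same j rewrite ≟-no i≢u | ≟-no i≢v = ∨-identityʳ (G i j)

  private
    deg-end : ∀ x y → x ≢ y → G x y ≡ false → Adj H x y →
              (∀ j → j ≢ y → H x j ≡ G x j) → deg H x ≡ suc (deg G x)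
    deg-end x y x≢y ¬xy hxy agree = begin
        deg H x                ≡⟨ deg-count H x ⟩
        count (H x)            ≡⟨ count-insert (H x) (G x) y hxy ¬xy agree ⟩
        suc (count (G x))      ≡⟨ cong suc (deg-count G x) ⟨
        suc (deg G x) ∎
      where open ≡-Reasoning

  deg-u : deg H u ≡ suc (deg G u)
  deg-u = deg-end u v u≢v ¬uv new-edge agree
    where
    agree : ∀ j → j ≢ v → H u j ≡ G u j
    agree j j≢v rewrite ≟-no j≢v | ≟-no u≢v | ≟-yes {x = u} refl = ∨-identityʳ (G u j)

  deg-v : deg H v ≡ suc (deg G v)
  deg-v = deg-end v u (≢-sym u≢v) (trans (proj₁ sG v u) ¬uv) (adj-sym simple new-edge) agree
    where
    agree : ∀ j → j ≢ u → H v j ≡ G v j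
    agree j j≢u rewrite ≟-no j≢u | ≟-no (≢-sym u≢v) | ≟-yes {x = v} refl = ∨-identityʳ (G v j)

  deg-grows : ∀ x → deg G x ≤ deg H x
  deg-grows x with x ≟⊎ u | x ≟⊎ v
  ... | inj₁ refl | _         = subst (deg G x ≤_) (sym deg-u) (n≤1+n _)
  ... | inj₂ _    | inj₁ refl = subst (deg G x ≤_) (sym deg-v) (n≤1+n _)
  ... | inj₂ x≢u  | inj₂ x≢v  = ≤-reflexive (sym (deg-other x x≢u x≢v))

-- Degree monotone paths on three and four vertices, oriented to be ascending (a descending path
-- is an ascending one read backwards).
Ascending3 : ∀ {n} → Graph n → Fin n → Fin n → Fin n → Set
Ascending3 G a b c = (a ≢ b × a ≢ c × b ≢ c) × (Adj G a b × Adj G b c) × (deg G a ≤ deg G b × deg G b ≤ deg G c)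

Ascending4 : ∀ {n} → Graph n → Fin n → Fin n → Fin n → Fin n → Set
Ascending4 G a b c d = (a ≢ b × a ≢ c × a ≢ d × b ≢ c × b ≢ d × c ≢ d) × (Adj G a b × Adj G b c × Adj G c d) ×
                       (deg G a ≤ deg G b × deg G b ≤ deg G c × deg G c ≤ deg G d)

∃Ascending3 : ∀ {n} → Graph n → Set
∃Ascending3 G = ∃ λ a → ∃ λ b → ∃ λ c → Ascending3 G a b c

∃Ascending4 : ∀ {n} → Graph n → Set
∃Ascending4 G = ∃ λ a → ∃ λ b → ∃ λ c → ∃ λ d → Ascending4 G a b c d

module MonotonePaths {n} (G : Graph n) (sG : Simple G) where

  ascending3-dmp : ∀ {a b c} → Ascending3 G a b c → IsDMP G (a ∷ b ∷ c ∷ [])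
  ascending3-dmp ((ab , ac , bc) , (e₁ , e₂) , (m₁ , m₂)) =
    (((ab ∷ ac ∷ []) ∷ (bc ∷ []) ∷ [] ∷ []) , (≡true⇒T e₁ ∷ ≡true⇒T e₂ ∷ [-])) , inj₁ (m₁ ∷ m₂ ∷ [-])

  ascending4-dmp : ∀ {a b c d} → Ascending4 G a b c d → IsDMP G (a ∷ b ∷ c ∷ d ∷ [])
  ascending4-dmp ((ab , ac , ad , bc , bd , cd) , (e₁ , e₂ , e₃) , (m₁ , m₂ , m₃)) =
    (((ab ∷ ac ∷ ad ∷ []) ∷ (bc ∷ bd ∷ []) ∷ (cd ∷ []) ∷ [] ∷ []) ,
     (≡true⇒T e₁ ∷ ≡true⇒T e₂ ∷ ≡true⇒T e₃ ∷ [-])) ,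
    inj₁ (m₁ ∷ m₂ ∷ m₃ ∷ [-])

  dmp-ascending3 : ∀ xs → IsDMP G xs → 3 ≤ length xs → ∃Ascending3 G
  dmp-ascending3 []           _ ()
  dmp-ascending3 (_ ∷ [])     _ (s≤s ())
  dmp-ascending3 (_ ∷ _ ∷ []) _ (s≤s (s≤s ()))
  dmp-ascending3 (a ∷ b ∷ c ∷ _) ((((ab ∷ ac ∷ _) ∷ (bc ∷ _) ∷ _) , (l₁ ∷ l₂ ∷ _)) , mono) _ with mono
  ... | inj₁ (m₁ ∷ m₂ ∷ _) = a , b , c , (ab , ac , bc) , (T⇒≡true l₁ , T⇒≡true l₂) , (m₁ , m₂)
  ... | inj₂ (m₁ ∷ m₂ ∷ _) =
    c , b , a , (≢-sym bc , ≢-sym ac , ≢-sym ab) , (adj-sym sG (T⇒≡true l₂) , adj-sym sG (T⇒≡true l₁)) , (m₂ , m₁)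

  dmp-ascending4 : ∀ xs → IsDMP G xs → 4 ≤ length xs → ∃Ascending4 G
  dmp-ascending4 []               _ ()
  dmp-ascending4 (_ ∷ [])         _ (s≤s ())
  dmp-ascending4 (_ ∷ _ ∷ [])     _ (s≤s (s≤s ()))
  dmp-ascending4 (_ ∷ _ ∷ _ ∷ []) _ (s≤s (s≤s (s≤s ())))
  dmp-ascending4 (a ∷ b ∷ c ∷ d ∷ _)
    ((((ab ∷ ac ∷ ad ∷ _) ∷ (bc ∷ bd ∷ _) ∷ (cd ∷ _) ∷ _) , (l₁ ∷ l₂ ∷ l₃ ∷ _)) , mono) _ with mono
  ... | inj₁ (m₁ ∷ m₂ ∷ m₃ ∷ _) =
    a , b , c , d , (ab , ac , ad , bc , bd , cd) , (T⇒≡true l₁ , T⇒≡true l₂ , T⇒≡true l₃) , (m₁ , m₂ , m₃)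
  ... | inj₂ (m₁ ∷ m₂ ∷ m₃ ∷ _) =
    d , c , b , a , (≢-sym cd , ≢-sym bd , ≢-sym ad , ≢-sym bc , ≢-sym ac , ≢-sym ab) ,
    (adj-sym sG (T⇒≡true l₃) , adj-sym sG (T⇒≡true l₂) , adj-sym sG (T⇒≡true l₁)) , (m₃ , m₂ , m₁)

  ascending3? : Dec (∃Ascending3 G)
  ascending3? = any? λ a → any? λ b → any? λ c →
    (¬? (a ≟ b) ×-dec ¬? (a ≟ c) ×-dec ¬? (b ≟ c)) ×-dec
    ((G a b ≟ᵇ true) ×-dec (G b c ≟ᵇ true)) ×-dec
    ((deg G a ≤? deg G b) ×-dec (deg G b ≤? deg G c))

  ascending4? : Dec (∃Ascending4 G)
  ascending4? = any? λ a → any? λ b → any? λ c → any? λ d →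
    (¬? (a ≟ b) ×-dec ¬? (a ≟ c) ×-dec ¬? (a ≟ d) ×-dec ¬? (b ≟ c) ×-dec ¬? (b ≟ d) ×-dec ¬? (c ≟ d)) ×-dec
    ((G a b ≟ᵇ true) ×-dec (G b c ≟ᵇ true) ×-dec (G c d ≟ᵇ true)) ×-dec
    ((deg G a ≤? deg G b) ×-dec (deg G b ≤? deg G c) ×-dec (deg G c ≤? deg G d))

  mp2-no-ascending3 : IsMP G 2 → ¬ ∃Ascending3 G
  mp2-no-ascending3 (_ , bound) (_ , _ , _ , t) with bound _ (ascending3-dmp t)
  ... | s≤s (s≤s ())

  mp3-no-ascending4 : IsMP G 3 → ¬ ∃Ascending4 G
  mp3-no-ascending4 (_ , bound) (_ , _ , _ , _ , q) with bound _ (ascending4-dmp q)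
  ... | s≤s (s≤s (s≤s ()))

  mp3-ascending3 : IsMP G 3 → ∃Ascending3 G
  mp3-ascending3 ((xs , dmp , len) , _) = dmp-ascending3 xs dmp (≤-reflexive (sym len))

  mp-edge : ∀ {k} → IsMP G k → 2 ≤ k → ∃ λ a → ∃ λ b → Adj G a b
  mp-edge ((a ∷ b ∷ _ , ((_ , (l ∷ _)) , _) , _) , _) _ = a , b , T⇒≡true l
  mp-edge (([]    , _ , refl) , _) ()
  mp-edge ((_ ∷ [] , _ , refl) , _) (s≤s ())

  mp2-criterion : ∀ {u v} → Adj G u v → ¬ ∃Ascending3 G → IsMP G 2
  mp2-criterion {u} {v} uv none = (u ∷ v ∷ [] , ((path , mono) , refl)) , bound
    where
    path : IsPath G (u ∷ v ∷ [])
    path = ((adj-irrefl sG uv ∷ []) ∷ [] ∷ []) , (≡true⇒T uv ∷ [-])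
    mono : DegMonotone G (u ∷ v ∷ [])
    mono with ≤-total (deg G u) (deg G v)
    ... | inj₁ u≤v = inj₁ (u≤v ∷ [-])
    ... | inj₂ v≤u = inj₂ (v≤u ∷ [-])
    bound : ∀ xs → IsDMP G xs → length xs ≤ 2
    bound xs dmp with 3 ≤? length xs
    ... | yes long = ⊥-elim (none (dmp-ascending3 xs dmp long))
    ... | no short = ≤-pred (≰⇒> short)

  mp3-criterion : ∃Ascending3 G → ¬ ∃Ascending4 G → IsMP G 3
  mp3-criterion (_ , _ , _ , t) none = ((_ , ascending3-dmp t , refl)) , bound
    where
    bound : ∀ xs → IsDMP G xs → length xs ≤ 3
    bound xs dmp with 4 ≤? length xs
    ... | yes long = ⊥-elim (none (dmp-ascending4 xs dmp long))
    ... | no short = ≤-pred (≰⇒> short)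

  mp≤3-criterion : ∀ {u v} → Adj G u v → ¬ ∃Ascending4 G → ∃ λ m → IsMP G m × m ≤ 3
  mp≤3-criterion uv none with ascending3?
  ... | no none3 = 2 , mp2-criterion uv none3 , s≤s (s≤s z≤n)
  ... | yes t    = 3 , mp3-criterion t none , ≤-refl

open MonotonePaths public

module _ {n} {G : Graph n} (sG : Simple G) (sat : Saturated G)
         {u v : Fin n} (u≢v : u ≢ v) (¬uv : G u v ≡ false) where
  open AddEdge G sG u v u≢v ¬uv using (H; simple; new-edge)

  saturated-mp2 : IsMP G 2 → ∃Ascending3 H
  saturated-mp2 mp with ascending3? H simple
  ... | yes t    = t
  ... | no none = ⊥-elim (<-irrefl refl (sat u v u≢v ¬uv 2 2 mp (mp2-criterion H simple new-edge none)))

  saturated-mp3 : IsMP G 3 → ∃Ascending4 H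
  saturated-mp3 mp with ascending4? H simple
  ... | yes q    = q
  ... | no none with m , mpH , m≤3 ← mp≤3-criterion H simple new-edge none =
    ⊥-elim (<-irrefl refl (≤-trans (sat u v u≢v ¬uv 3 m mp mpH) m≤3))

module Connectivity {n} {G : Graph n} (sG : Simple G) (cG : Connected G) where

  positive-degree : ∀ {a b} → Adj G a b → ∀ x → 1 ≤ deg G x
  positive-degree {a} {b} ab x with cG x a
  ... | here       = deg≥1 G a b ab
  ... | step xy _  = deg≥1 G x _ (T⇒≡true xy)

  K2-component : ∀ {u w} → deg G u ≡ 1 → deg G w ≡ 1 → Adj G u w → ∀ x → x ≡ u ⊎ x ≡ w
  K2-component {u} {w} du dw uw = connected-closed cG (λ x → x ≡ u ⊎ x ≡ w) u (inj₁ refl) closed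
    where
    closed : ∀ x y → x ≡ u ⊎ x ≡ w → Adj G x y → y ≡ u ⊎ y ≡ w
    closed x y (inj₁ refl) xy = inj₂ (only-neighbour G u w du uw y xy)
    closed x y (inj₂ refl) xy = inj₁ (only-neighbour G w u dw (adj-sym sG uw) y xy)

  P3-component : ∀ {u w z} → deg G u ≡ 1 → deg G w ≡ 2 → deg G z ≡ 1 → Adj G u w → Adj G w z → z ≢ u →
                 ∀ x → x ≡ u ⊎ x ≡ w ⊎ x ≡ z
  P3-component {u} {w} {z} du dw dz uw wz z≢u =
    connected-closed cG (λ x → x ≡ u ⊎ x ≡ w ⊎ x ≡ z) u (inj₁ refl) closed
    where
    closed : ∀ x y → x ≡ u ⊎ x ≡ w ⊎ x ≡ z → Adj G x y → y ≡ u ⊎ y ≡ w ⊎ y ≡ z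
    closed x y (inj₁ refl)        xy = inj₂ (inj₁ (only-neighbour G u w du uw y xy))
    closed x y (inj₂ (inj₁ refl)) xy with two-neighbours G w u z dw (adj-sym sG uw) wz z≢u y xy
    ... | inj₁ y≡u = inj₁ y≡u
    ... | inj₂ y≡z = inj₂ (inj₂ y≡z)
    closed x y (inj₂ (inj₂ refl)) xy = inj₂ (inj₁ (only-neighbour G z w dz (adj-sym sG wz) y xy))

  P4-component : ∀ {u w z y} → deg G u ≡ 1 → deg G w ≡ 2 → deg G z ≡ 2 → deg G y ≡ 1 →
                 Adj G u w → Adj G w z → Adj G z y → z ≢ u → y ≢ w → ∀ x → x ≡ u ⊎ x ≡ w ⊎ x ≡ z ⊎ x ≡ y
  P4-component {u} {w} {z} {y} du dw dz dy uw wz zy z≢u y≢w =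
    connected-closed cG P4 u (inj₁ refl) closed
    where
    P4 : Fin n → Set
    P4 x = x ≡ u ⊎ x ≡ w ⊎ x ≡ z ⊎ x ≡ y
    closed : ∀ a b → P4 a → Adj G a b → P4 b
    closed a b (inj₁ refl) ab = inj₂ (inj₁ (only-neighbour G u w du uw b ab))
    closed a b (inj₂ (inj₁ refl)) ab with two-neighbours G w u z dw (adj-sym sG uw) wz z≢u b ab
    ... | inj₁ b≡u = inj₁ b≡u
    ... | inj₂ b≡z = inj₂ (inj₂ (inj₁ b≡z))
    closed a b (inj₂ (inj₂ (inj₁ refl))) ab with two-neighbours G z w y dz (adj-sym sG wz) zy y≢w b ab
    ... | inj₁ b≡w = inj₂ (inj₁ b≡w)
    ... | inj₂ b≡y = inj₂ (inj₂ (inj₂ b≡y))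
    closed a b (inj₂ (inj₂ (inj₂ refl))) ab = inj₂ (inj₂ (inj₁ (only-neighbour G y z dy (adj-sym sG zy) b ab)))

IsStarCentre : ∀ {n} → Graph n → Fin n → Set
IsStarCentre {n} G w = (∀ x → x ≢ w → Adj G x w) × (∀ x y → x ≢ w → y ≢ w → G x y ≡ false) × (∃ λ u → u ≢ w)

module Mp2 {n} (G : Graph n) (sG : Simple G) (sat : Saturated G) (cG : Connected G) (mp : IsMP G 2) where
  open Connectivity sG cG

  private
    d : Fin n → ℕ
    d = deg G

    no-ascending3 : ∀ {a b c} → ¬ Ascending3 G a b c
    no-ascending3 t = mp2-no-ascending3 G sG mp (_ , _ , _ , t)

  not-ascending : ∀ {a b c} → Adj G a b → Adj G b c → a ≢ c → d a ≤ d b → d b ≤ d c → ⊥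
  not-ascending ab bc a≢c a≤b b≤c = no-ascending3 ((adj-irrefl sG ab , a≢c , adj-irrefl sG bc) , (ab , bc) , (a≤b , b≤c))

  not-descending : ∀ {a b c} → Adj G a b → Adj G b c → a ≢ c → d c ≤ d b → d b ≤ d a → ⊥
  not-descending ab bc a≢c = not-ascending (adj-sym sG bc) (adj-sym sG ab) (≢-sym a≢c)

  peak-or-valley : ∀ {a b c} → Adj G a b → Adj G b c → a ≢ c → (d a < d b × d c < d b) ⊎ (d b < d a × d b < d c)
  peak-or-valley {a} {b} {c} ab bc a≢c with <-cmp (d a) (d b) | <-cmp (d b) (d c)
  ... | tri< a<b _ _ | tri> _ _ c<b = inj₁ (a<b , c<b)
  ... | tri> _ _ b<a | tri< b<c _ _ = inj₂ (b<a , b<c)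
  ... | tri< a<b _ _ | tri< b<c _ _ = ⊥-elim (not-ascending ab bc a≢c (<⇒≤ a<b) (<⇒≤ b<c))
  ... | tri< a<b _ _ | tri≈ _ b≡c _ = ⊥-elim (not-ascending ab bc a≢c (<⇒≤ a<b) (≤-reflexive b≡c))
  ... | tri≈ _ a≡b _ | tri< b<c _ _ = ⊥-elim (not-ascending ab bc a≢c (≤-reflexive a≡b) (<⇒≤ b<c))
  ... | tri≈ _ a≡b _ | tri≈ _ b≡c _ = ⊥-elim (not-ascending ab bc a≢c (≤-reflexive a≡b) (≤-reflexive b≡c))
  ... | tri≈ _ a≡b _ | tri> _ _ c<b = ⊥-elim (not-descending ab bc a≢c (<⇒≤ c<b) (≤-reflexive (sym a≡b)))
  ... | tri> _ _ b<a | tri≈ _ b≡c _ = ⊥-elim (not-descending ab bc a≢c (≤-reflexive (sym b≡c)) (<⇒≤ b<a))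
  ... | tri> _ _ b<a | tri> _ _ c<b = ⊥-elim (not-descending ab bc a≢c (<⇒≤ c<b) (<⇒≤ b<a))

  Peak : Fin n → Set
  Peak x = ∀ y → Adj G x y → d y < d x

  -- One smaller neighbour makes x a peak (x cannot be a valley).
  peak-from : ∀ {x y} → Adj G x y → d y < d x → Peak x
  peak-from {x} {y} xy y<x z xz with z ≟ y
  ... | yes refl = y<x
  ... | no  z≢y with peak-or-valley (adj-sym sG xy) xz (≢-sym z≢y)
  ...   | inj₁ (_ , z<x) = z<x
  ...   | inj₂ (x<y , _) = ⊥-elim (<-asym y<x x<y)

  -- Saturation excludes a leaf u at a vertex w of degree ≥ 3 together with a peak v ≠ w of degree ≥ 2:
  -- G + uv would have no ascending 3-path.
  module NoSecondPeak (u w v : Fin n) (du : d u ≡ 1) (uw : Adj G u w) (dw≥3 : 3 ≤ d w)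
                      (peak-v : Peak v) (v≢w : v ≢ w) (dv≥2 : 2 ≤ d v) where
    u≢v : u ≢ v
    u≢v refl = <-irrefl (sym du) dv≥2

    ¬uv : G u v ≡ false
    ¬uv = ¬-not λ uv → v≢w (only-neighbour G u w du uw v uv)

    open AddEdge G sG u v u≢v ¬uv

    Hu : deg H u ≡ 2
    Hu = trans deg-u (cong suc du)

    Hv : 3 ≤ deg H v
    Hv = subst (3 ≤_) (sym deg-v) (s≤s dv≥2)

    Hw : 3 ≤ deg H w
    Hw = subst (3 ≤_) (sym (deg-other w (≢-sym (adj-irrefl sG uw)) (≢-sym v≢w))) dw≥3

    H-no-ascending3 : ∀ {a b c} → ¬ Ascending3 H a b c
    H-no-ascending3 {a} {b} {c} ((a≢b , a≢c , b≢c) , (ab , bc) , (a≤b , b≤c)) with b ≟⊎ u | b ≟⊎ v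
    -- b = u: both H-neighbours of u have degree ≥ 3 > deg u
    ... | inj₁ refl | _ with u-neighbours (only-neighbour G u w du uw) a (adj-sym simple ab)
    ...   | inj₁ refl = <⇒≱ (subst (_< deg H a) (sym Hu) Hw) a≤b
    ...   | inj₂ refl = <⇒≱ (subst (_< deg H a) (sym Hu) Hv) a≤b
    H-no-ascending3 {a} {b} {c} ((a≢b , a≢c , b≢c) , (ab , bc) , (a≤b , b≤c)) | inj₂ b≢u | inj₁ refl
    -- b = v: c is u (smaller degree in H) or a G-neighbour of the peak v
      with edge-cases bc
    ... | inj₂ (inj₁ (v≡u , _)) = u≢v (sym v≡u)
    ... | inj₂ (inj₂ (_ , refl)) = <⇒≱ (subst (_< deg H v) (sym Hu) Hv) b≤c
    ... | inj₁ vc with c ≟⊎ u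
    ...   | inj₁ refl = true≢false (trans (sym (adj-sym sG vc)) ¬uv)
    ...   | inj₂ c≢u = <⇒≱ (peak-v c vc) (≤-trans (n≤1+n _) (subst₂ _≤_ deg-v (deg-other c c≢u (≢-sym b≢c)) b≤c))
    H-no-ascending3 {a} {b} {c} ((a≢b , a≢c , b≢c) , (ab , bc) , (a≤b , b≤c)) | inj₂ b≢u | inj₂ b≢v
    -- b ∉ {u, v}: a b c is a path of G, and its middle b is a peak or a valley there
      with peak-or-valley (adj-sym sG (old-off-uv b≢u b≢v (adj-sym simple ab))) (old-off-uv b≢u b≢v bc) a≢c
    ... | inj₂ (b<a , _) = <⇒≱ (subst (_< deg H a) (sym (deg-other b b≢u b≢v)) (≤-trans b<a (deg-grows a))) a≤b
    ... | inj₁ (_ , c<b) with c ≟⊎ u | c ≟⊎ v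
    ...   | inj₁ refl | _ = <⇒≱ (subst (λ x → 2 < d x) (sym b≡w) dw≥3) (subst₂ _≤_ (deg-other b b≢u b≢v) Hu b≤c)
      where
      b≡w : b ≡ w
      b≡w = only-neighbour G u w du uw b (adj-sym sG (old-off-uv b≢u b≢v bc))
    ...   | inj₂ _ | inj₁ refl = <-asym c<b (peak-v b (adj-sym sG (old-off-uv b≢u b≢v bc)))
    ...   | inj₂ c≢u | inj₂ c≢v = <⇒≱ c<b (subst₂ _≤_ (deg-other b b≢u b≢v) (deg-other c c≢u c≢v) b≤c)

    contradiction : ⊥
    contradiction with _ , _ , _ , t ← saturated-mp2 sG sat u≢v ¬uv mp = H-no-ascending3 t

  module Leaf (u w : Fin n) (du : d u ≡ 1) (uw : Adj G u w) (pos : ∀ x → 1 ≤ d x) where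
    u≢w : u ≢ w
    u≢w = adj-irrefl sG uw

    excluded : 3 ≤ d w → ∀ v → Peak v → v ≢ w → 2 ≤ d v → ⊥
    excluded dw≥3 v = NoSecondPeak.contradiction u w v du uw dw≥3

    others-are-leaves : ∀ x → x ≢ w → d x ≡ 1
    others-are-leaves x x≢w with d w ≤? 1 | d w ≤? 2
    -- deg w = 1: G is the edge uw
    ... | yes dw≤1 | _ with K2-component du (≤-antisym dw≤1 (pos w)) uw x
    ...   | inj₁ refl = du
    ...   | inj₂ x≡w  = ⊥-elim (x≢w x≡w)
    -- deg w = 2: w is a peak, its other neighbour z is a leaf, and G is the path u w z
    others-are-leaves x x≢w | no dw≰1 | yes dw≤2 with z , z≢u , wz ← second-neighbour G w u (≰⇒> dw≰1) (adj-sym sG uw)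
      = cover (P3-component du dw dz uw wz z≢u x)
      where
      dw : d w ≡ 2
      dw = ≤-antisym dw≤2 (≰⇒> dw≰1)
      dz : d z ≡ 1
      dz with peak-or-valley uw wz (≢-sym z≢u)
      ... | inj₁ (_ , z<w) = ≤-antisym (≤-pred (subst (d z <_) dw z<w)) (pos z)
      ... | inj₂ (w<u , _) = ⊥-elim (<⇒≱ w<u (subst₂ _≤_ (sym du) (sym dw) (s≤s z≤n)))
      cover : x ≡ u ⊎ x ≡ w ⊎ x ≡ z → d x ≡ 1
      cover (inj₁ refl)        = du
      cover (inj₂ (inj₁ x≡w))  = ⊥-elim (x≢w x≡w)
      cover (inj₂ (inj₂ refl)) = dz
    -- deg w ≥ 3: a non-leaf x ≠ w would yield a peak of degree ≥ 2 other than w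
    others-are-leaves x x≢w | no _ | no dw≰2 with d x ≤? 1
    ... | yes dx≤1 = ≤-antisym dx≤1 (pos x)
    ... | no  dx≰1 with y₁ , xy₁ ← neighbour G x (pos x)
                   with y₂ , y₂≢y₁ , xy₂ ← second-neighbour G x y₁ (≰⇒> dx≰1) xy₁
                   with peak-or-valley (adj-sym sG xy₁) xy₂ (≢-sym y₂≢y₁)
    ...   | inj₁ (y₁<x , _) = ⊥-elim (excluded (≰⇒> dw≰2) x (peak-from xy₁ y₁<x) x≢w (≰⇒> dx≰1))
    ...   | inj₂ (x<y₁ , x<y₂) with y₁ ≟⊎ w
    ...     | inj₁ refl = ⊥-elim (excluded (≰⇒> dw≰2) y₂ (peak-from (adj-sym sG xy₂) x<y₂) y₂≢y₁
                                          (≤-trans (≰⇒> dx≰1) (<⇒≤ x<y₂)))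
    ...     | inj₂ y₁≢w = ⊥-elim (excluded (≰⇒> dw≰2) y₁ (peak-from (adj-sym sG xy₁) x<y₁) y₁≢w
                                          (≤-trans (≰⇒> dx≰1) (<⇒≤ x<y₁)))

    -- every x ≠ w is a leaf whose neighbour is w (else x and its neighbour would form all of G)
    attached : ∀ x → x ≢ w → Adj G x w
    attached x x≢w with y , xy ← neighbour G x (pos x) with y ≟⊎ w
    ... | inj₁ refl = xy
    ... | inj₂ y≢w with K2-component (others-are-leaves x x≢w) (others-are-leaves y y≢w) xy w
    ...   | inj₁ w≡x = ⊥-elim (x≢w (sym w≡x))
    ...   | inj₂ w≡y = ⊥-elim (y≢w (sym w≡y))

    star : IsStarCentre G w
    star = attached ,
           (λ x y x≢w y≢w → ¬-not λ xy → y≢w (only-neighbour G x w (others-are-leaves x x≢w) (attached x x≢w) y xy)) ,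
           (u , u≢w)

  star-centre : edgeCount G ≤ n → ∃ λ w → IsStarCentre G w
  star-centre e≤n with a , b , ab ← mp-edge G sG mp (s≤s (s≤s z≤n))
    with one-or-constant-two n d (positive-degree ab) (degree-sum-bound G sG e≤n)
  ... | inj₁ (u , du) with w , uw ← neighbour G u (≤-reflexive (sym du)) = w , Leaf.star u w du uw (positive-degree ab)
  -- 2-regular: a 3-vertex path c a b would be ascending
  ... | inj₂ all2 with c , c≢b , ac ← second-neighbour G a b (≤-reflexive (sym (all2 a))) ab =
    ⊥-elim (not-ascending (adj-sym sG ac) ab c≢b (≤-reflexive (trans (all2 c) (sym (all2 a))))
                                                 (≤-reflexive (trans (all2 a) (sym (all2 b)))))

-- A graph with a star centre w is isomorphic to a star: transpose w with the centre 0.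
module StarIso {Δ} (G : Graph (suc Δ)) (sG : Simple G) (w : Fin (suc Δ)) (star : IsStarCentre G w) where
  to : Fin (suc Δ) → Fin (suc Δ)
  to = transpose w fzero

  from : Fin (suc Δ) → Fin (suc Δ)
  from = transpose fzero w

  to-centre : to w ≡ fzero
  to-centre rewrite dec-true (w ≟ w) refl = refl

  to-rim : ∀ x → x ≢ w → ∃ λ k → to x ≡ fsuc k
  to-rim x x≢w with to x in tx
  ... | fsuc k = k , refl
  ... | fzero  = ⊥-elim (x≢w (begin
    x             ≡⟨ transpose-inverse fzero w ⟨
    from (to x)   ≡⟨ cong from (trans tx (sym to-centre)) ⟩
    from (to w)   ≡⟨ transpose-inverse fzero w ⟩
    w             ∎))
    where open ≡-Reasoning

  preserves : ∀ i j → G i j ≡ Star Δ (to i) (to j)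
  preserves i j with i ≟⊎ w | j ≟⊎ w
  ... | inj₁ refl | inj₁ refl rewrite to-centre = proj₂ sG w
  ... | inj₁ refl | inj₂ j≢w  with _ , tj ← to-rim j j≢w rewrite to-centre | tj = adj-sym sG (proj₁ star j j≢w)
  ... | inj₂ i≢w  | inj₁ refl with _ , ti ← to-rim i i≢w rewrite to-centre | ti = proj₁ star i i≢w
  ... | inj₂ i≢w  | inj₂ j≢w  with _ , ti ← to-rim i i≢w | _ , tj ← to-rim j j≢w rewrite ti | tj =
    proj₁ (proj₂ star) i j i≢w j≢w

  iso : Iso G (Star Δ)
  iso = record { f = to ; g = from ; gf = λ _ → transpose-inverse fzero w ; fg = λ _ → transpose-inverse w fzero
               ; pres = preserves }

-- Joining two leaves u, v of a star with centre w creates a triangle uvw with pendant leaves at w;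
-- its longest degree monotone path is u v w.
module StarPlusEdge {n} (G : Graph n) (sG : Simple G) (w : Fin n) (star : IsStarCentre G w)
                    (u v : Fin n) (u≢v : u ≢ v) (¬uv : G u v ≡ false) where
  open AddEdge G sG u v u≢v ¬uv

  private
    spoke : ∀ x → x ≢ w → Adj G x w
    spoke = proj₁ star

  u≢w : u ≢ w
  u≢w refl = true≢false (trans (sym (adj-sym sG (spoke v (≢-sym u≢v)))) ¬uv)

  v≢w : v ≢ w
  v≢w refl = true≢false (trans (sym (spoke u u≢v)) ¬uv)

  to-centre : ∀ x → x ≢ w → ∀ y → Adj G x y → y ≡ w
  to-centre x x≢w y xy with y ≟⊎ w
  ... | inj₁ y≡w = y≡w
  ... | inj₂ y≢w = ⊥-elim (true≢false (trans (sym xy) (proj₁ (proj₂ star) x y x≢w y≢w)))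

  leaf-degree : ∀ x → x ≢ w → deg G x ≡ 1
  leaf-degree x x≢w = deg≡1 G x w (spoke x x≢w) (to-centre x x≢w)

  Hu : deg H u ≡ 2
  Hu = trans deg-u (cong suc (leaf-degree u u≢w))

  Hv : deg H v ≡ 2
  Hv = trans deg-v (cong suc (leaf-degree v v≢w))

  Hw : deg H w ≡ deg G w
  Hw = deg-other w (≢-sym u≢w) (≢-sym v≢w)

  w-uv : 2 ≤ deg G w
  w-uv = deg≥2 G w u v (adj-sym sG (spoke u u≢w)) (adj-sym sG (spoke v v≢w)) (≢-sym u≢v)

  u-nbrs : ∀ y → Adj H u y → y ≡ w ⊎ y ≡ v
  u-nbrs = u-neighbours (to-centre u u≢w)

  v-nbrs : ∀ y → Adj H v y → y ≡ w ⊎ y ≡ u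
  v-nbrs = v-neighbours (to-centre v v≢w)

  branching : ∀ x → 2 ≤ deg H x → x ≡ w ⊎ x ≡ u ⊎ x ≡ v
  branching x Hx≥2 with x ≟⊎ w | x ≟⊎ u | x ≟⊎ v
  ... | inj₁ x≡w | _        | _        = inj₁ x≡w
  ... | inj₂ _   | inj₁ x≡u | _        = inj₂ (inj₁ x≡u)
  ... | inj₂ _   | inj₂ _   | inj₁ x≡v = inj₂ (inj₂ x≡v)
  ... | inj₂ x≢w | inj₂ x≢u | inj₂ x≢v = ⊥-elim (<-irrefl refl (subst (2 ≤_) (trans (deg-other x x≢u x≢v) (leaf-degree x x≢w)) Hx≥2))

  w-third : ∀ x → Adj H w x → x ≢ u → x ≢ v → 3 ≤ deg H w
  w-third x wx x≢u x≢v with edge-cases wx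
  ... | inj₂ (inj₁ (w≡u , _)) = ⊥-elim (u≢w (sym w≡u))
  ... | inj₂ (inj₂ (w≡v , _)) = ⊥-elim (v≢w (sym w≡v))
  ... | inj₁ wx′ = subst (3 ≤_) (sym Hw)
                     (deg≥3 G w u v x (adj-sym sG (spoke u u≢w)) (adj-sym sG (spoke v v≢w)) wx′ (≢-sym u≢v) x≢u x≢v)

  -- Case analysis on the two interior vertices b, c ∈ {w, u, v} of an ascending path a b c e.
  no-ascending4 : ∀ {a b c e} → ¬ Ascending4 H a b c e
  no-ascending4 {a} {b} {c} {e} ((a≢b , a≢c , a≢e , b≢c , b≢e , c≢e) , (ab , bc , ce) , (a≤b , b≤c , c≤e))
    with branching b (deg≥2 H b a c (adj-sym simple ab) bc (≢-sym a≢c))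
       | branching c (deg≥2 H c b e (adj-sym simple bc) ce (≢-sym b≢e))
  ... | inj₁ refl        | inj₁ refl        = b≢c refl
  ... | inj₂ (inj₁ refl) | inj₂ (inj₁ refl) = b≢c refl
  ... | inj₂ (inj₂ refl) | inj₂ (inj₂ refl) = b≢c refl
  -- b = w: the third neighbour a of w gives deg w ≥ 3, but deg w ≤ deg c = 2
  ... | inj₁ refl | inj₂ (inj₁ refl) with u-nbrs e ce
  ...   | inj₁ refl = b≢e refl
  ...   | inj₂ refl = <⇒≱ (w-third a (adj-sym simple ab) a≢c a≢e) (subst (deg H w ≤_) Hu b≤c)
  no-ascending4 ((a≢b , a≢c , a≢e , b≢c , b≢e , c≢e) , (ab , bc , ce) , (a≤b , b≤c , c≤e)) | inj₁ refl | inj₂ (inj₂ refl)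
    with v-nbrs _ ce
  ...   | inj₁ refl = b≢e refl
  ...   | inj₂ refl = <⇒≱ (w-third _ (adj-sym simple ab) a≢e a≢c) (subst (deg H w ≤_) Hv b≤c)
  -- c = w: a is the other vertex of {u, v}, and so is e (deg e ≥ deg w ≥ 2)
  no-ascending4 ((a≢b , a≢c , a≢e , b≢c , b≢e , c≢e) , (ab , bc , ce) , (a≤b , b≤c , c≤e)) | inj₂ (inj₁ refl) | inj₁ refl
    with u-nbrs _ (adj-sym simple ab) | branching _ (≤-trans (subst (_≤ deg H w) Hu b≤c) c≤e)
  ...   | inj₁ refl | _                       = a≢c refl
  ...   | inj₂ refl | inj₁ refl               = c≢e refl
  ...   | inj₂ refl | inj₂ (inj₁ refl)        = b≢e refl
  ...   | inj₂ refl | inj₂ (inj₂ refl)        = a≢e refl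
  no-ascending4 ((a≢b , a≢c , a≢e , b≢c , b≢e , c≢e) , (ab , bc , ce) , (a≤b , b≤c , c≤e)) | inj₂ (inj₂ refl) | inj₁ refl
    with v-nbrs _ (adj-sym simple ab) | branching _ (≤-trans (subst (_≤ deg H w) Hv b≤c) c≤e)
  ...   | inj₁ refl | _                       = a≢c refl
  ...   | inj₂ refl | inj₁ refl               = c≢e refl
  ...   | inj₂ refl | inj₂ (inj₁ refl)        = a≢e refl
  ...   | inj₂ refl | inj₂ (inj₂ refl)        = b≢e refl
  -- {b, c} = {u, v}: both a and e must be w
  no-ascending4 ((a≢b , a≢c , a≢e , b≢c , b≢e , c≢e) , (ab , bc , ce) , (a≤b , b≤c , c≤e)) | inj₂ (inj₁ refl) | inj₂ (inj₂ refl)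
    with u-nbrs _ (adj-sym simple ab) | v-nbrs _ ce
  ...   | inj₂ refl | _         = a≢c refl
  ...   | _         | inj₂ refl = b≢e refl
  ...   | inj₁ refl | inj₁ refl = a≢e refl
  no-ascending4 ((a≢b , a≢c , a≢e , b≢c , b≢e , c≢e) , (ab , bc , ce) , (a≤b , b≤c , c≤e)) | inj₂ (inj₂ refl) | inj₂ (inj₁ refl)
    with v-nbrs _ (adj-sym simple ab) | u-nbrs _ ce
  ...   | inj₂ refl | _         = a≢c refl
  ...   | _         | inj₂ refl = b≢e refl
  ...   | inj₁ refl | inj₁ refl = a≢e refl

  mp3 : IsMP H 3
  mp3 = mp3-criterion H simple (u , v , w , uvw) (λ (_ , _ , _ , _ , q) → no-ascending4 q)
    where
    uvw : Ascending3 H u v w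
    uvw = (u≢v , u≢w , v≢w) , (new-edge , old-edge (spoke v v≢w)) ,
          (≤-reflexive (trans Hu (sym Hv)) , subst₂ _≤_ (sym Hv) (sym Hw) w-uv)

module TriangleIso {n} (G : Graph n) (sG : Simple G) (a b c : Fin n) (ab : Adj G a b) (bc : Adj G b c) (ac : Adj G a c)
                   (cover : ∀ x → x ≡ a ⊎ x ≡ b ⊎ x ≡ c) where
  from : Fin 3 → Fin n
  from fzero               = a
  from (fsuc fzero)        = b
  from (fsuc (fsuc fzero)) = c

  index : ∀ {x} → x ≡ a ⊎ x ≡ b ⊎ x ≡ c → Fin 3
  index (inj₁ _)        = fzero
  index (inj₂ (inj₁ _)) = fsuc fzero
  index (inj₂ (inj₂ _)) = fsuc (fsuc fzero)

  to : Fin n → Fin 3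
  to x = index (cover x)

  from-index : ∀ {x} (p : x ≡ a ⊎ x ≡ b ⊎ x ≡ c) → from (index p) ≡ x
  from-index (inj₁ x≡a)        = sym x≡a
  from-index (inj₂ (inj₁ x≡b)) = sym x≡b
  from-index (inj₂ (inj₂ x≡c)) = sym x≡c

  from-to : ∀ x → from (to x) ≡ x
  from-to x = from-index (cover x)

  edges : ∀ s t → G (from s) (from t) ≡ K3 s t
  edges fzero               fzero               = proj₂ sG a
  edges fzero               (fsuc fzero)        = ab
  edges fzero               (fsuc (fsuc fzero)) = ac
  edges (fsuc fzero)        fzero               = adj-sym sG ab
  edges (fsuc fzero)        (fsuc fzero)        = proj₂ sG b
  edges (fsuc fzero)        (fsuc (fsuc fzero)) = bc
  edges (fsuc (fsuc fzero)) fzero               = adj-sym sG ac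
  edges (fsuc (fsuc fzero)) (fsuc fzero)        = adj-sym sG bc
  edges (fsuc (fsuc fzero)) (fsuc (fsuc fzero)) = proj₂ sG c

  -- from is injective since an edge joins distinct vertices
  from-injective : ∀ s t → from s ≡ from t → s ≡ t
  from-injective s t eq with s ≟ t
  ... | yes s≡t = s≡t
  ... | no  s≢t = ⊥-elim (true≢false (begin
      true                  ≡⟨ K3-off ⟨
      K3 s t                ≡⟨ edges s t ⟨
      G (from s) (from t)   ≡⟨ cong (λ x → G x (from t)) eq ⟩
      G (from t) (from t)   ≡⟨ proj₂ sG (from t) ⟩
      false                 ∎))
    where
    open ≡-Reasoning
    K3-off : K3 s t ≡ true
    K3-off rewrite ≟-no s≢t = refl

  iso : Iso G K3
  iso = record
    { f    = to
    ; g    = from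
    ; gf   = from-to
    ; fg   = λ t → from-injective (to (from t)) t (from-to (from t))
    ; pres = λ i j → trans (sym (cong₂ G (from-to i) (from-to j))) (edges (to i) (to j))
    }

module Mp3 {n} (G : Graph n) (sG : Simple G) (sat : Saturated G) (cG : Connected G) (mp : IsMP G 3)
           (pos : ∀ x → 1 ≤ deg G x) where
  open Connectivity sG cG

  private
    d : Fin n → ℕ
    d = deg G

    no-ascending4 : ∀ {a b c e} → ¬ Ascending4 G a b c e
    no-ascending4 q = mp3-no-ascending4 G sG mp (_ , _ , _ , _ , q)

    leaf : ∀ {x} → d x ≤ 1 → d x ≡ 1
    leaf {x} dx≤1 = ≤-antisym dx≤1 (pos x)

  -- A pendant path u w z (u a leaf, deg w = 2, deg z ≤ 2) leaves no room for a vertex v of degree ≥ 2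
  -- elsewhere: either the path closes off a component, or it extends to an ascending 4-path.
  pendant-path : ∀ {u w z v} → d u ≡ 1 → Adj G u w → d w ≡ 2 → Adj G w z → z ≢ u → d z ≤ 2 →
                 v ≢ u → v ≢ w → v ≢ z → 2 ≤ d v → ⊥
  pendant-path {u} {w} {z} {v} du uw dw wz z≢u dz≤2 v≢u v≢w v≢z dv≥2 with d z ≤? 1
  ... | yes dz≤1 with P3-component du dw (leaf dz≤1) uw wz z≢u v
  ...   | inj₁ v≡u        = v≢u v≡u
  ...   | inj₂ (inj₁ v≡w) = v≢w v≡w
  ...   | inj₂ (inj₂ v≡z) = v≢z v≡z
  pendant-path {u} {w} {z} {v} du uw dw wz z≢u dz≤2 v≢u v≢w v≢z dv≥2 | no dz≰1
    with y , y≢w , zy ← second-neighbour G z w (≰⇒> dz≰1) (adj-sym sG wz) with d y ≤? 1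
  ... | no dy≰1 = no-ascending4 ((adj-irrefl sG uw , ≢-sym z≢u , ≢-sym y≢u ,
                                  adj-irrefl sG wz , ≢-sym y≢w , adj-irrefl sG zy) ,
                                 (uw , wz , zy) ,
                                 (subst₂ _≤_ (sym du) (sym dw) (s≤s z≤n) , ≤-reflexive (trans dw (sym dz)) ,
                                  subst (_≤ d y) (sym dz) (≰⇒> dy≰1)))
    where
    dz : d z ≡ 2
    dz = ≤-antisym dz≤2 (≰⇒> dz≰1)
    y≢u : y ≢ u
    y≢u refl = adj-irrefl sG wz (sym (only-neighbour G u w du uw z (adj-sym sG zy)))
  ... | yes dy≤1 with P4-component du dw dz (leaf dy≤1) uw wz zy z≢u y≢w v
    where
    dz : d z ≡ 2
    dz = ≤-antisym dz≤2 (≰⇒> dz≰1)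
  ...   | inj₁ v≡u                 = v≢u v≡u
  ...   | inj₂ (inj₁ v≡w)          = v≢w v≡w
  ...   | inj₂ (inj₂ (inj₁ v≡z))   = v≢z v≡z
  ...   | inj₂ (inj₂ (inj₂ refl))  = <-irrefl (sym (leaf dy≤1)) dv≥2

  -- Saturation forbids a leaf u whose neighbour w is not a vertex v of maximum degree (deg v ≥ 2):
  -- in G + uv, v is the unique maximum, and no ascending 4-path survives.
  module LeafAwayFromMaximum (u w v : Fin n) (du : d u ≡ 1) (uw : Adj G u w) (maximum : ∀ x → d x ≤ d v)
                             (v≢w : v ≢ w) (v≢u : v ≢ u) (dv≥2 : 2 ≤ d v) where
    u≢v : u ≢ v
    u≢v = ≢-sym v≢u

    ¬uv : G u v ≡ false
    ¬uv = ¬-not λ uv → v≢w (only-neighbour G u w du uw v uv)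

    open AddEdge G sG u v u≢v ¬uv

    w≢u : w ≢ u
    w≢u = ≢-sym (adj-irrefl sG uw)

    Hu : deg H u ≡ 2
    Hu = trans deg-u (cong suc du)

    below-v : ∀ y → y ≢ v → deg H y ≤ d v
    below-v y y≢v with y ≟⊎ u
    ... | inj₁ refl = subst (_≤ d v) (sym Hu) dv≥2
    ... | inj₂ y≢u  = subst (_≤ d v) (sym (deg-other y y≢u y≢v)) (maximum y)

    only-v-above-v : ∀ {y} → deg H v ≤ deg H y → y ≡ v
    only-v-above-v {y} v≤y with y ≟⊎ v
    ... | inj₁ y≡v = y≡v
    ... | inj₂ y≢v = ⊥-elim (<⇒≱ (s≤s (below-v y y≢v)) (subst (_≤ deg H y) deg-v v≤y))

    -- an H-neighbour x of w with deg x ≤ deg w ≤ 2 would make u w x a pendant path of G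
    via-w : ∀ {x} → Adj H w x → x ≢ u → deg H w ≤ 2 → deg H x ≤ deg H w → x ≢ v → ⊥
    via-w {x} wx x≢u Hw≤2 x≤w x≢v = pendant-path du uw dw wx′ x≢u dx≤2 v≢u v≢w (≢-sym x≢v) dv≥2
      where
      wx′ : Adj G w x
      wx′ = old-off-u w≢u x≢u wx
      Hw : deg H w ≡ d w
      Hw = deg-other w w≢u (≢-sym v≢w)
      dw : d w ≡ 2
      dw = ≤-antisym (subst (_≤ 2) Hw Hw≤2) (deg≥2 G w u x (adj-sym sG uw) wx′ x≢u)
      dx≤2 : d x ≤ 2
      dx≤2 = subst (_≤ 2) (deg-other x x≢u x≢v) (≤-trans x≤w Hw≤2)

    not-v : ∀ {x y} → x ≢ y → deg H x ≤ deg H y → x ≢ v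
    not-v x≢y x≤y refl = x≢y (sym (only-v-above-v x≤y))

    degree-step : ∀ {x y} → x ≢ u → y ≢ u → x ≢ v → deg H x ≤ deg H y → d x ≤ d y
    degree-step {x} {y} x≢u y≢u x≢v x≤y with y ≟⊎ v
    ... | inj₁ refl = maximum x
    ... | inj₂ y≢v  = subst₂ _≤_ (deg-other x x≢u x≢v) (deg-other y y≢u y≢v) x≤y

    u-nbrs : ∀ y → Adj H u y → y ≡ w ⊎ y ≡ v
    u-nbrs = u-neighbours (only-neighbour G u w du uw)

    H-no-ascending4 : ∀ {a b c e} → ¬ Ascending4 H a b c e
    H-no-ascending4 {a} {b} {c} {e} ((a≢b , a≢c , a≢e , b≢c , b≢e , c≢e) , (ab , bc , ce) , (a≤b , b≤c , c≤e))
      with b ≟⊎ u | c ≟⊎ u | e ≟⊎ u | a ≟⊎ u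
    -- b = u: a and c are both the H-neighbour w of u
    ... | inj₁ refl | _ | _ | _ with u-nbrs a (adj-sym simple ab) | u-nbrs c bc
    ...   | inj₂ refl | _         = not-v a≢b a≤b refl
    ...   | _         | inj₂ refl = not-v c≢e c≤e refl
    ...   | inj₁ refl | inj₁ refl = a≢c refl
    H-no-ascending4 ((a≢b , a≢c , a≢e , b≢c , b≢e , c≢e) , (ab , bc , ce) , (a≤b , b≤c , c≤e))
      | inj₂ b≢u | inj₁ refl | _ | _
    -- c = u: b is w, and u w a is a pendant path
      with u-nbrs _ (adj-sym simple bc)
    ... | inj₂ refl = not-v b≢c b≤c refl
    ... | inj₁ refl = via-w (adj-sym simple ab) a≢c (subst (deg H w ≤_) Hu b≤c) a≤b (not-v a≢b a≤b)
    H-no-ascending4 ((a≢b , a≢c , a≢e , b≢c , b≢e , c≢e) , (ab , bc , ce) , (a≤b , b≤c , c≤e))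
      | inj₂ b≢u | inj₂ c≢u | inj₁ refl | _
    -- e = u: c is w, and u w b is a pendant path
      with u-nbrs _ (adj-sym simple ce)
    ... | inj₂ refl = not-v c≢e c≤e refl
    ... | inj₁ refl = via-w (adj-sym simple bc) b≢u (subst (deg H w ≤_) Hu c≤e) b≤c (not-v b≢c b≤c)
    H-no-ascending4 ((a≢b , a≢c , a≢e , b≢c , b≢e , c≢e) , (ab , bc , ce) , (a≤b , b≤c , c≤e))
      | inj₂ b≢u | inj₂ c≢u | inj₂ e≢u | inj₁ refl
    -- a = u: b is w, and u w c e is already an ascending path of G
      with u-nbrs _ ab
    ... | inj₂ refl = not-v b≢c b≤c refl
    ... | inj₁ refl = no-ascending4 ((a≢b , a≢c , a≢e , b≢c , b≢e , c≢e) ,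
                                     (uw , old-off-u w≢u c≢u bc , old-off-u c≢u e≢u ce) ,
                                     (subst (_≤ d w) (sym du) (pos w) ,
                                      subst₂ _≤_ (deg-other w w≢u (≢-sym v≢w)) (deg-other _ c≢u (not-v c≢e c≤e)) b≤c ,
                                      degree-step c≢u e≢u (not-v c≢e c≤e) c≤e))
    H-no-ascending4 ((a≢b , a≢c , a≢e , b≢c , b≢e , c≢e) , (ab , bc , ce) , (a≤b , b≤c , c≤e))
      | inj₂ b≢u | inj₂ c≢u | inj₂ e≢u | inj₂ a≢u
    -- u not on the path: it is an ascending path of G
      = no-ascending4 ((a≢b , a≢c , a≢e , b≢c , b≢e , c≢e) ,
                       (old-off-u a≢u b≢u ab , old-off-u b≢u c≢u bc , old-off-u c≢u e≢u ce) ,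
                       (degree-step a≢u b≢u (not-v a≢b a≤b) a≤b , degree-step b≢u c≢u (not-v b≢c b≤c) b≤c ,
                        degree-step c≢u e≢u (not-v c≢e c≤e) c≤e))

    contradiction : ⊥
    contradiction with _ , _ , _ , _ , q ← saturated-mp3 sG sat u≢v ¬uv mp = H-no-ascending4 q

  -- Saturation forbids two leaves u₀, u₁ at the unique vertex k of maximum degree ≥ 3: in G + u₀u₁,
  -- k stays the unique maximum, and every ascending 4-path would already lie in G.
  module TwoLeavesAtMaximum (k u₀ u₁ : Fin n) (unique-max : ∀ x → x ≢ k → d x < d k) (dk≥3 : 3 ≤ d k)
                            (du₀ : d u₀ ≡ 1) (du₁ : d u₁ ≡ 1) (u₀k : Adj G u₀ k) (u₁k : Adj G u₁ k)
                            (u₀≢u₁ : u₀ ≢ u₁) where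
    u₀≢k : u₀ ≢ k
    u₀≢k = adj-irrefl sG u₀k

    u₁≢k : u₁ ≢ k
    u₁≢k = adj-irrefl sG u₁k

    ¬u₀u₁ : G u₀ u₁ ≡ false
    ¬u₀u₁ = ¬-not λ u₀u₁ → u₁≢k (only-neighbour G u₀ k du₀ u₀k u₁ u₀u₁)

    open AddEdge G sG u₀ u₁ u₀≢u₁ ¬u₀u₁

    below-k : ∀ y → y ≢ k → deg H y < d k
    below-k y y≢k with y ≟⊎ u₀ | y ≟⊎ u₁
    ... | inj₁ refl | _         = subst (_< d k) (sym (trans deg-u (cong suc du₀))) dk≥3
    ... | inj₂ _    | inj₁ refl = subst (_< d k) (sym (trans deg-v (cong suc du₁))) dk≥3
    ... | inj₂ y≢u₀ | inj₂ y≢u₁ = subst (_< d k) (sym (deg-other y y≢u₀ y≢u₁)) (unique-max y y≢k)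

    not-k : ∀ {x y} → x ≢ y → deg H x ≤ deg H y → x ≢ k
    not-k {x} {y} x≢y x≤y refl with y ≟⊎ k
    ... | inj₁ refl = x≢y refl
    ... | inj₂ y≢k  = <⇒≱ (below-k y y≢k) (subst (_≤ deg H y) (deg-other k (≢-sym u₀≢k) (≢-sym u₁≢k)) x≤y)

    nbrs₀ : ∀ y → Adj H u₀ y → y ≡ k ⊎ y ≡ u₁
    nbrs₀ = u-neighbours (only-neighbour G u₀ k du₀ u₀k)

    nbrs₁ : ∀ y → Adj H u₁ y → y ≡ k ⊎ y ≡ u₀
    nbrs₁ = v-neighbours (only-neighbour G u₁ k du₁ u₁k)

    off₀ : ∀ {x y} → Adj H x y → y ≢ k → y ≢ u₁ → x ≢ u₀
    off₀ xy y≢k y≢u₁ refl with nbrs₀ _ xy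
    ... | inj₁ y≡k  = y≢k y≡k
    ... | inj₂ y≡u₁ = y≢u₁ y≡u₁

    off₁ : ∀ {x y} → Adj H x y → y ≢ k → y ≢ u₀ → x ≢ u₁
    off₁ xy y≢k y≢u₀ refl with nbrs₁ _ xy
    ... | inj₁ y≡k  = y≢k y≡k
    ... | inj₂ y≡u₀ = y≢u₀ y≡u₀

    H-no-ascending4 : ∀ {a b c e} → ¬ Ascending4 H a b c e
    H-no-ascending4 {a} {b} {c} {e} ((a≢b , a≢c , a≢e , b≢c , b≢e , c≢e) , (ab , bc , ce) , (a≤b , b≤c , c≤e))
      with b ≟⊎ u₀ | b ≟⊎ u₁ | c ≟⊎ u₀ | c ≟⊎ u₁
    -- b ∈ {u₀, u₁}: both path-neighbours a, c of b would be the other leaf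
    ... | inj₁ refl | _ | _ | _ with nbrs₀ a (adj-sym simple ab) | nbrs₀ c bc
    ...   | inj₁ refl | _         = not-k a≢b a≤b refl
    ...   | _         | inj₁ refl = not-k c≢e c≤e refl
    ...   | inj₂ refl | inj₂ refl = a≢c refl
    H-no-ascending4 {a} {b} {c} {e} ((a≢b , a≢c , a≢e , b≢c , b≢e , c≢e) , (ab , bc , ce) , (a≤b , b≤c , c≤e))
      | inj₂ _ | inj₁ refl | _ | _ with nbrs₁ a (adj-sym simple ab) | nbrs₁ c bc
    ...   | inj₁ refl | _         = not-k a≢b a≤b refl
    ...   | _         | inj₁ refl = not-k c≢e c≤e refl
    ...   | inj₂ refl | inj₂ refl = a≢c refl
    -- c ∈ {u₀, u₁}: b would be k or the other leaf
    H-no-ascending4 {a} {b} {c} {e} ((a≢b , a≢c , a≢e , b≢c , b≢e , c≢e) , (ab , bc , ce) , (a≤b , b≤c , c≤e))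
      | inj₂ b≢u₀ | inj₂ b≢u₁ | inj₁ refl | _ with nbrs₀ b (adj-sym simple bc)
    ...   | inj₁ refl = not-k b≢c b≤c refl
    ...   | inj₂ b≡u₁ = b≢u₁ b≡u₁
    H-no-ascending4 {a} {b} {c} {e} ((a≢b , a≢c , a≢e , b≢c , b≢e , c≢e) , (ab , bc , ce) , (a≤b , b≤c , c≤e))
      | inj₂ b≢u₀ | inj₂ b≢u₁ | inj₂ _ | inj₁ refl with nbrs₁ b (adj-sym simple bc)
    ...   | inj₁ refl = not-k b≢c b≤c refl
    ...   | inj₂ b≡u₀ = b≢u₀ b≡u₀
    -- b, c ∉ {u₀, u₁}: then neither are a, e, and the path lies in G with unchanged degrees
    H-no-ascending4 {a} {b} {c} {e} ((a≢b , a≢c , a≢e , b≢c , b≢e , c≢e) , (ab , bc , ce) , (a≤b , b≤c , c≤e))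
      | inj₂ b≢u₀ | inj₂ b≢u₁ | inj₂ c≢u₀ | inj₂ c≢u₁ =
      no-ascending4 ((a≢b , a≢c , a≢e , b≢c , b≢e , c≢e) ,
                     (old-off-uv a≢u₀ a≢u₁ ab , old-off-uv b≢u₀ b≢u₁ bc , old-off-uv c≢u₀ c≢u₁ ce) ,
                     (subst₂ _≤_ (deg-other a a≢u₀ a≢u₁) (deg-other b b≢u₀ b≢u₁) a≤b ,
                      subst₂ _≤_ (deg-other b b≢u₀ b≢u₁) (deg-other c c≢u₀ c≢u₁) b≤c ,
                      subst₂ _≤_ (deg-other c c≢u₀ c≢u₁) (deg-other e e≢u₀ e≢u₁) c≤e))
      where
      b≢k : b ≢ k
      b≢k = not-k b≢c b≤c
      c≢k : c ≢ k
      c≢k = not-k c≢e c≤e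
      a≢u₀ : a ≢ u₀
      a≢u₀ = off₀ ab b≢k b≢u₁
      a≢u₁ : a ≢ u₁
      a≢u₁ = off₁ ab b≢k b≢u₀
      e≢u₀ : e ≢ u₀
      e≢u₀ = off₀ (adj-sym simple ce) c≢k c≢u₁
      e≢u₁ : e ≢ u₁
      e≢u₁ = off₁ (adj-sym simple ce) c≢k c≢u₀

    contradiction : ⊥
    contradiction with _ , _ , _ , _ , q ← saturated-mp3 sG sat u₀≢u₁ ¬u₀u₁ mp = H-no-ascending4 q

  module SingleLeafAtMaximum (avg : ∑ n d ≤ n * 2) (k u₀ : Fin n) (unique-max : ∀ x → x ≢ k → d x < d k)
                             (dk≥3 : 3 ≤ d k) (du₀ : d u₀ ≡ 1) (u₀k : Adj G u₀ k)
                             (non-leaf : ∀ x → x ≢ u₀ → 2 ≤ d x) where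
    u₀≢k : u₀ ≢ k
    u₀≢k = adj-irrefl sG u₀k

    -- Degree sum: 2 + [x = k] ≤ d x + [x = u₀] pointwise, while both sides sum to at most 2n + 1;
    -- hence deg k = 3 and every other vertex besides u₀ has degree 2.
    lower upper : Fin n → ℕ
    lower x = 2 + b2n ⌊ x ≟ k ⌋
    upper x = d x + b2n ⌊ x ≟ u₀ ⌋

    lower≤upper : ∀ x → lower x ≤ upper x
    lower≤upper x with x ≟⊎ u₀ | x ≟⊎ k
    ... | inj₁ refl | _ rewrite ≟-no u₀≢k | ≟-yes {x = u₀} refl | du₀ = ≤-refl
    ... | inj₂ x≢u₀ | inj₁ refl rewrite ≟-yes {x = k} refl | ≟-no x≢u₀ = subst (3 ≤_) (sym (+-identityʳ _)) dk≥3
    ... | inj₂ x≢u₀ | inj₂ x≢k rewrite ≟-no x≢k | ≟-no x≢u₀ = subst (2 ≤_) (sym (+-identityʳ _)) (non-leaf x x≢u₀)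

    totals : ∑ n upper ≤ ∑ n lower
    totals = begin
      ∑ n upper                                ≡⟨ ∑-+ n d _ ⟩
      ∑ n d + count (λ x → ⌊ x ≟ u₀ ⌋)         ≡⟨ cong (∑ n d +_) (count-point u₀) ⟩
      ∑ n d + 1                                ≤⟨ +-monoˡ-≤ 1 avg ⟩
      n * 2 + 1                                ≡⟨ cong₂ _+_ (∑-const n 2) (count-point k) ⟨
      ∑ n (λ _ → 2) + count (λ x → ⌊ x ≟ k ⌋)  ≡⟨ ∑-+ n (λ _ → 2) _ ⟨
      ∑ n lower                                ∎
      where open ≤-Reasoning

    tight : ∀ x → upper x ≤ lower x
    tight = ∑-squeeze n lower≤upper totals

    off-u₀ : ∀ x → x ≢ u₀ → d x ≤ lower x
    off-u₀ x x≢u₀ = subst (_≤ lower x) (trans (cong (λ t → d x + b2n t) (≟-no x≢u₀)) (+-identityʳ (d x))) (tight x)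

    dk : d k ≡ 3
    dk = ≤-antisym (subst (d k ≤_) (cong (λ t → 2 + b2n t) (≟-yes {x = k} refl)) (off-u₀ k (≢-sym u₀≢k))) dk≥3

    two : ∀ x → x ≢ u₀ → x ≢ k → d x ≡ 2
    two x x≢u₀ x≢k = ≤-antisym (subst (d x ≤_) (cong (λ t → 2 + b2n t) (≟-no x≢k)) (off-u₀ x x≢u₀)) (non-leaf x x≢u₀)

    k-neighbours : ∀ {x y} → Adj G k x → Adj G k y → x ≢ u₀ → y ≢ u₀ → y ≢ x →
                   ∀ z → Adj G k z → z ≡ u₀ ⊎ z ≡ x ⊎ z ≡ y
    k-neighbours kx ky x≢u₀ y≢u₀ y≢x = three-neighbours G k u₀ _ _ dk (adj-sym sG u₀k) kx ky x≢u₀ y≢u₀ y≢x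

    -- If two neighbours x, y of k are adjacent, G is the paw (triangle kxy with pendant u₀), and
    -- G + u₀x has degrees 2, 3, 3, 2 at u₀, k, x, y: too few for an ascending 4-path.
    module Paw (x y : Fin n) (kx : Adj G k x) (ky : Adj G k y) (xy : Adj G x y)
               (x≢u₀ : x ≢ u₀) (y≢u₀ : y ≢ u₀) (y≢x : y ≢ x) where
      x≢k : x ≢ k
      x≢k = ≢-sym (adj-irrefl sG kx)
      y≢k : y ≢ k
      y≢k = ≢-sym (adj-irrefl sG ky)

      ¬u₀x : G u₀ x ≡ false
      ¬u₀x = ¬-not λ u₀x → x≢k (only-neighbour G u₀ k du₀ u₀k x u₀x)

      Vertex : Fin n → Set
      Vertex z = z ≡ u₀ ⊎ z ≡ k ⊎ z ≡ x ⊎ z ≡ y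

      closed : ∀ a b → Vertex a → Adj G a b → Vertex b
      closed a b (inj₁ refl) ab = inj₂ (inj₁ (only-neighbour G u₀ k du₀ u₀k b ab))
      closed a b (inj₂ (inj₁ refl)) ab with k-neighbours kx ky x≢u₀ y≢u₀ y≢x b ab
      ... | inj₁ b≡u₀        = inj₁ b≡u₀
      ... | inj₂ (inj₁ b≡x) = inj₂ (inj₂ (inj₁ b≡x))
      ... | inj₂ (inj₂ b≡y) = inj₂ (inj₂ (inj₂ b≡y))
      closed a b (inj₂ (inj₂ (inj₁ refl))) ab with two-neighbours G x k y (two x x≢u₀ x≢k) (adj-sym sG kx) xy y≢k b ab
      ... | inj₁ b≡k = inj₂ (inj₁ b≡k)
      ... | inj₂ b≡y = inj₂ (inj₂ (inj₂ b≡y))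
      closed a b (inj₂ (inj₂ (inj₂ refl))) ab
        with two-neighbours G y k x (two y y≢u₀ y≢k) (adj-sym sG ky) (adj-sym sG xy) x≢k b ab
      ... | inj₁ b≡k = inj₂ (inj₁ b≡k)
      ... | inj₂ b≡x = inj₂ (inj₂ (inj₁ b≡x))

      vertices : ∀ z → Vertex z
      vertices = connected-closed cG Vertex u₀ (inj₁ refl) closed

      open AddEdge G sG u₀ x (≢-sym x≢u₀) ¬u₀x

      Hu₀ : deg H u₀ ≡ 2
      Hu₀ = trans deg-u (cong suc du₀)
      Hx : deg H x ≡ 3
      Hx = trans deg-v (cong suc (two x x≢u₀ x≢k))
      Hk : deg H k ≡ 3
      Hk = trans (deg-other k (≢-sym u₀≢k) (≢-sym x≢k)) dk
      Hy : deg H y ≡ 2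
      Hy = trans (deg-other y y≢u₀ y≢x) (two y y≢u₀ y≢k)

      low : ∀ z → deg H z ≤ 2 → z ≡ u₀ ⊎ z ≡ y
      low z Hz≤2 with vertices z
      ... | inj₁ z≡u₀               = inj₁ z≡u₀
      ... | inj₂ (inj₁ refl)        = ⊥-elim (<⇒≱ (≤-reflexive (sym Hk)) Hz≤2)
      ... | inj₂ (inj₂ (inj₁ refl)) = ⊥-elim (<⇒≱ (≤-reflexive (sym Hx)) Hz≤2)
      ... | inj₂ (inj₂ (inj₂ z≡y))  = inj₂ z≡y

      high : ∀ z → 3 ≤ deg H z → z ≡ k ⊎ z ≡ x
      high z Hz≥3 with vertices z
      ... | inj₁ refl               = ⊥-elim (<⇒≱ Hz≥3 (≤-reflexive Hu₀))
      ... | inj₂ (inj₁ z≡k)         = inj₁ z≡k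
      ... | inj₂ (inj₂ (inj₁ z≡x))  = inj₂ z≡x
      ... | inj₂ (inj₂ (inj₂ refl)) = ⊥-elim (<⇒≱ Hz≥3 (≤-reflexive Hy))

      u₀≁y : ¬ Adj H u₀ y
      u₀≁y u₀y with u-neighbours (only-neighbour G u₀ k du₀ u₀k) y u₀y
      ... | inj₁ y≡k = y≢k y≡k
      ... | inj₂ y≡x = y≢x y≡x

      -- a low b would force the edge u₀y; a high b puts b, c, e into the two-element set {k, x}
      H-no-ascending4 : ∀ {a b c e} → ¬ Ascending4 H a b c e
      H-no-ascending4 {a} {b} {c} {e} ((a≢b , a≢c , a≢e , b≢c , b≢e , c≢e) , (ab , bc , ce) , (a≤b , b≤c , c≤e))
        with deg H b ≤? 2
      ... | yes Hb≤2 with low a (≤-trans a≤b Hb≤2) | low b Hb≤2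
      ...   | inj₁ refl | inj₁ refl = a≢b refl
      ...   | inj₁ refl | inj₂ refl = u₀≁y ab
      ...   | inj₂ refl | inj₁ refl = u₀≁y (adj-sym simple ab)
      ...   | inj₂ refl | inj₂ refl = a≢b refl
      H-no-ascending4 {a} {b} {c} {e} ((a≢b , a≢c , a≢e , b≢c , b≢e , c≢e) , (ab , bc , ce) , (a≤b , b≤c , c≤e))
        | no Hb≰2 with high b (≰⇒> Hb≰2) | high c (≤-trans (≰⇒> Hb≰2) b≤c) | high e (≤-trans (≤-trans (≰⇒> Hb≰2) b≤c) c≤e)
      ... | inj₁ refl | inj₁ refl | _         = b≢c refl
      ... | inj₂ refl | inj₂ refl | _         = b≢c refl
      ... | inj₁ refl | inj₂ refl | inj₁ refl = b≢e refl
      ... | inj₁ refl | inj₂ refl | inj₂ refl = c≢e refl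
      ... | inj₂ refl | inj₁ refl | inj₁ refl = c≢e refl
      ... | inj₂ refl | inj₁ refl | inj₂ refl = b≢e refl

      contradiction : ⊥
      contradiction with _ , _ , _ , _ , q ← saturated-mp3 sG sat (≢-sym x≢u₀) ¬u₀x mp = H-no-ascending4 q

    not-u₀ : ∀ {z w} → Adj G z w → w ≢ k → z ≢ u₀
    not-u₀ zw w≢k refl = w≢k (only-neighbour G u₀ k du₀ u₀k _ zw)

    two-off-k : ∀ {z w} → Adj G z w → w ≢ k → z ≢ k → d z ≡ 2
    two-off-k zw w≢k = two _ (not-u₀ zw w≢k)

    -- Otherwise the other neighbour x′ of x, and the other neighbour x″ of x′, give the ascending
    -- path x″ x′ x k with degrees 2, 2, 2, 3.
    long-path : ∀ {x y x′} → Adj G k x → Adj G k y → x ≢ u₀ → y ≢ u₀ → y ≢ x →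
                Adj G x x′ → x′ ≢ k → x′ ≢ y → ⊥
    long-path {x} {y} {x′} kx ky x≢u₀ y≢u₀ y≢x xx′ x′≢k x′≢y
      with x″ , x″≢x , x′x″ ← second-neighbour G x′ x
                                (≤-reflexive (sym (two-off-k (adj-sym sG xx′) (≢-sym (adj-irrefl sG kx)) x′≢k)))
                                (adj-sym sG xx′)
      = no-ascending4 ((adj-irrefl sG (adj-sym sG x′x″) , x″≢x , x″≢k , ≢-sym (adj-irrefl sG xx′) , x′≢k , x≢k) ,
                       (adj-sym sG x′x″ , adj-sym sG xx′ , adj-sym sG kx) ,
                       (≤-reflexive (trans dx″ (sym dx′)) , ≤-reflexive (trans dx′ (sym dx)) ,
                        subst₂ _≤_ (sym dx) (sym dk) (s≤s (s≤s z≤n))))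
      where
      x≢k : x ≢ k
      x≢k = ≢-sym (adj-irrefl sG kx)
      x′≢u₀ : x′ ≢ u₀
      x′≢u₀ = not-u₀ (adj-sym sG xx′) x≢k
      dx : d x ≡ 2
      dx = two x x≢u₀ x≢k
      dx′ : d x′ ≡ 2
      dx′ = two-off-k (adj-sym sG xx′) x≢k x′≢k
      x″≢k : x″ ≢ k
      x″≢k refl with k-neighbours kx ky x≢u₀ y≢u₀ y≢x x′ (adj-sym sG x′x″)
      ... | inj₁ x′≡u₀        = x′≢u₀ x′≡u₀
      ... | inj₂ (inj₁ x′≡x) = adj-irrefl sG xx′ (sym x′≡x)
      ... | inj₂ (inj₂ x′≡y) = x′≢y x′≡y
      dx″ : d x″ ≡ 2
      dx″ = two-off-k (adj-sym sG x′x″) x′≢k x″≢k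

    contradiction : ⊥
    contradiction
      with x , x≢u₀ , kx ← second-neighbour G k u₀ (≤-trans (s≤s (s≤s z≤n)) dk≥3) (adj-sym sG u₀k)
      with y , y≢u₀ , y≢x , ky ← third-neighbour G k u₀ x dk≥3 (adj-sym sG u₀k) kx x≢u₀
      with x′ , x′≢k , xx′ ← second-neighbour G x k (≤-reflexive (sym (two x x≢u₀ (≢-sym (adj-irrefl sG kx)))))
                                                 (adj-sym sG kx)
      with x′ ≟⊎ y
    ... | inj₁ refl = Paw.contradiction x x′ kx ky xx′ x≢u₀ y≢u₀ y≢x
    ... | inj₂ x′≢y = long-path kx ky x≢u₀ y≢u₀ y≢x xx′ x′≢k x′≢y

  module LeafCase (avg : ∑ n d ≤ n * 2) (u₀ : Fin n) (du₀ : d u₀ ≡ 1) (m : Fin n) (maximum : ∀ x → d x ≤ d m) where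
    -- the middle of an ascending 3-path has degree ≥ 2
    dm≥2 : 2 ≤ d m
    dm≥2 with _ , b , c , (_ , a≢c , _) , (ab , bc) , _ ← mp3-ascending3 G sG mp =
      ≤-trans (deg≥2 G b _ c (adj-sym sG ab) bc (≢-sym a≢c)) (maximum b)

    m≢leaf : ∀ {u} → d u ≡ 1 → m ≢ u
    m≢leaf du refl = <-irrefl (sym du) dm≥2

    -- if some leaf is not attached to m, saturation is violated
    all-attached : ∀ u → d u ≡ 1 → Adj G u m
    all-attached u du with G u m in um
    ... | true  = refl
    ... | false with w , uw ← neighbour G u (≤-reflexive (sym du)) =
      ⊥-elim (LeafAwayFromMaximum.contradiction u w m du uw maximum m≢w (m≢leaf du) dm≥2)
      where
      m≢w : m ≢ w
      m≢w refl = true≢false (trans (sym uw) um)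

    -- m is the unique vertex of maximum degree: a second one, v, would be a maximum away from the
    -- leaf u₀ at m
    unique-max : ∀ x → x ≢ m → d x < d m
    unique-max v v≢m with d m ≤? d v
    ... | no  m≰v = ≰⇒> m≰v
    ... | yes m≤v = ⊥-elim (LeafAwayFromMaximum.contradiction u₀ m v du₀ (all-attached u₀ du₀)
                              (λ x → ≤-trans (maximum x) m≤v) v≢m
                              (λ { refl → <-irrefl (sym du₀) (≤-trans dm≥2 m≤v) }) (≤-trans dm≥2 m≤v))

    -- deg m = 2 makes G the path u₀ m z, where an ascending 3-path a b c would need two vertices
    -- b, c of degree ≥ 2
    not-path : d m ≢ 2
    not-path dm with z , z≢u₀ , mz ← second-neighbour G m u₀ dm≥2 (adj-sym sG (all-attached u₀ du₀))
                with _ , b , c , (_ , a≢c , b≢c) , (ab , bc) , (_ , b≤c) ← mp3-ascending3 G sG mp =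
      b≢c (trans (central b db≥2) (sym (central c (≤-trans db≥2 b≤c))))
      where
      dz : d z ≡ 1
      dz = ≤-antisym (≤-pred (subst (d z <_) dm (unique-max z (≢-sym (adj-irrefl sG mz))))) (pos z)
      central : ∀ x → 2 ≤ d x → x ≡ m
      central x dx≥2 with P3-component du₀ dm dz (all-attached u₀ du₀) mz z≢u₀ x
      ... | inj₁ refl        = ⊥-elim (<-irrefl (sym du₀) dx≥2)
      ... | inj₂ (inj₁ x≡m)  = x≡m
      ... | inj₂ (inj₂ refl) = ⊥-elim (<-irrefl (sym dz) dx≥2)
      db≥2 : 2 ≤ d b
      db≥2 = deg≥2 G b _ c (adj-sym sG ab) bc (≢-sym a≢c)

    contradiction : ⊥
    contradiction with d m ≤? 2
    ... | yes dm≤2 = not-path (≤-antisym dm≤2 dm≥2)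
    ... | no  dm≰2 with any? (λ u → ¬? (u ≟ u₀) ×-dec (d u ≟ℕ 1))
    ...   | yes (u₁ , u₁≢u₀ , du₁) = TwoLeavesAtMaximum.contradiction m u₀ u₁ unique-max (≰⇒> dm≰2) du₀ du₁
                                        (all-attached u₀ du₀) (all-attached u₁ du₁) (≢-sym u₁≢u₀)
    ...   | no  one-leaf = SingleLeafAtMaximum.contradiction avg m u₀ unique-max (≰⇒> dm≰2) du₀
                                                          (all-attached u₀ du₀) non-leaf
      where
      non-leaf : ∀ x → x ≢ u₀ → 2 ≤ d x
      non-leaf x x≢u₀ with d x ≤? 1
      ... | yes dx≤1 = ⊥-elim (one-leaf (x , x≢u₀ , leaf dx≤1))
      ... | no  dx≰1 = ≰⇒> dx≰1

  -- 2-regular: for an edge ab, let c and e be the other neighbours of a and b.  If e ≠ c, then c a b e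
  -- is an ascending 4-path; so abc is a triangle, closed under adjacency, hence all of G.
  regular-triangle : ∀ {a b} → Adj G a b → (∀ x → d x ≡ 2) → Iso G K3
  regular-triangle {a} {b} ab all2
    with c , c≢b , ac ← second-neighbour G a b (≤-reflexive (sym (all2 a))) ab
    with e , e≢a , be ← second-neighbour G b a (≤-reflexive (sym (all2 b))) (adj-sym sG ab)
    with e ≟⊎ c
  ... | inj₂ e≢c = ⊥-elim (no-ascending4
        ((≢-sym (adj-irrefl sG ac) , c≢b , ≢-sym e≢c , adj-irrefl sG ab , ≢-sym e≢a , adj-irrefl sG be) ,
         (adj-sym sG ac , ab , be) ,
         (≤-reflexive (trans (all2 c) (sym (all2 a))) , ≤-reflexive (trans (all2 a) (sym (all2 b))) ,
          ≤-reflexive (trans (all2 b) (sym (all2 e))))))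
  ... | inj₁ refl = TriangleIso.iso G sG a b e ab be ac (connected-closed cG Triangle a (inj₁ refl) closed)
    where
    Triangle : Fin n → Set
    Triangle x = x ≡ a ⊎ x ≡ b ⊎ x ≡ e
    closed : ∀ x y → Triangle x → Adj G x y → Triangle y
    closed x y (inj₁ refl) xy with two-neighbours G a b e (all2 a) ab ac c≢b y xy
    ... | inj₁ y≡b = inj₂ (inj₁ y≡b)
    ... | inj₂ y≡e = inj₂ (inj₂ y≡e)
    closed x y (inj₂ (inj₁ refl)) xy with two-neighbours G b a e (all2 b) (adj-sym sG ab) be e≢a y xy
    ... | inj₁ y≡a = inj₁ y≡a
    ... | inj₂ y≡e = inj₂ (inj₂ y≡e)
    closed x y (inj₂ (inj₂ refl)) xy with two-neighbours G e a b (all2 e) (adj-sym sG ac) (adj-sym sG be)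
                                                        (≢-sym (adj-irrefl sG ab)) y xy
    ... | inj₁ y≡a = inj₁ y≡a
    ... | inj₂ y≡b = inj₂ (inj₁ y≡b)

  triangle : ∑ n d ≤ n * 2 → Iso G K3
  triangle avg with a , b , ab ← mp-edge G sG mp (s≤s (s≤s z≤n)) with one-or-constant-two n d pos avg
  ... | inj₂ all2 = regular-triangle ab all2
  ... | inj₁ (u₀ , du₀) with m , maximum ← argmax d u₀ = ⊥-elim (LeafCase.contradiction avg u₀ du₀ m maximum)

distinct⇒1≤ : ∀ {Δ} {u w : Fin (suc Δ)} → u ≢ w → 1 ≤ Δ
distinct⇒1≤ {zero}  {fzero} {fzero} u≢w = ⊥-elim (u≢w refl)
distinct⇒1≤ {suc Δ}                 _   = s≤s z≤n

lemma3p2 : ∀ {n} (G : Graph n) → Simple G → Saturated G → Connected G →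
    edgeCount G ≤ n → ∀ (k : ℕ) → IsMP G k → 2 ≤ k → k ≤ 3 →
    (k ≡ 2 → Σ ℕ (λ Δ → 1 ≤ Δ × Iso G (Star Δ) ×
        (2 ≤ Δ → ∀ (u v : Fin n) → u ≢ v → G u v ≡ false → IsMP (addEdge G u v) 3)))
    × (k ≡ 3 → Iso G K3)
lemma3p2 {zero} G sG sat cG e≤n k mp 2≤k k≤3 with () , _ ← mp-edge G sG mp 2≤k
lemma3p2 {suc Δ} G sG sat cG e≤n k mp 2≤k k≤3 = case-mp2 , case-mp3
  where
  case-mp2 : k ≡ 2 → Σ ℕ (λ Δ′ → 1 ≤ Δ′ × Iso G (Star Δ′) ×
               (2 ≤ Δ′ → ∀ (u v : Fin (suc Δ)) → u ≢ v → G u v ≡ false → IsMP (addEdge G u v) 3))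
  case-mp2 refl with w , star ← Mp2.star-centre G sG sat cG mp e≤n =
    Δ , distinct⇒1≤ (proj₂ (proj₂ (proj₂ star))) , StarIso.iso G sG w star ,
    λ _ u v u≢v ¬uv → StarPlusEdge.mp3 G sG w star u v u≢v ¬uv

  case-mp3 : k ≡ 3 → Iso G K3
  case-mp3 refl with a , b , ab ← mp-edge G sG mp 2≤k =
    Mp3.triangle G sG sat cG mp (Connectivity.positive-degree sG cG ab) (degree-sum-bound G sG e≤n)
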